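{- Let $q$ be an odd prime power, $t$ a positive integer, $n=2t$, $\xi\in\mathbb{F}_{q^n}\setminus\mathbb{F}_{q^t}$, and let $A,B\in\mathbb{F}_{q^t}$ with $\xi^2=A\xi+B$, where $\mathrm{Tr}_{q^t/q}(A)\neq-2$. Let $L=L_{S_{\mathrm{Tr}_{q^t/q},\xi}\times S_{\mathrm{Tr}_{q^t/q},\xi}}$. Then for every point $\langle(1,\alpha)\rangle_{\mathbb{F}_{q^n}}\in L$ (with $\alpha\in\mathbb{F}_{q^n}$), $$w_L(\langle(1,\alpha)\rangle_{\mathbb{F}_{q^n}})=\begin{cases}1,&\alpha\notin\mathbb{F}_{q^t},\\ t-2,&\alpha\in\mathbb{F}_{q^t}\setminus\mathbb{F}_q,\\ t,&\alpha\in\mathbb{F}_q^*.\end{cases}$$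
   Context: $\mathrm{Tr}_{q^t/q}(x)=\sum_{i=0}^{t-1}x^{q^i}$. For an $\mathbb{F}_q$-linear map $h$ of $\mathbb{F}_{q^t}$ and $\zeta\in\mathbb{F}_{q^{2t}}\setminus\mathbb{F}_{q^t}$, $S_{h,\zeta}=\{u+\zeta h(u): u\in\mathbb{F}_{q^t}\}$. For an $\mathbb{F}_q$-subspace $U$ of $\mathbb{F}_{q^n}^2$, $L_U=\{\langle u\rangle_{\mathbb{F}_{q^n}}: u\in U\setminus\{0\}\}\subseteq\mathrm{PG}(1,q^n)$ and the weight of a point $\langle v\rangle_{\mathbb{F}_{q^n}}$ is $w_{L_U}(\langle v\rangle)=\dim_{\mathbb{F}_q}(U\cap\langle v\rangle_{\mathbb{F}_{q^n}})$. $S\times T=\{(s,t):s\in S,t\in T\}$. -}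

module Defs where

open import Level using (0ℓ)
open import Algebra.Bundles using (CommutativeRing)
open import Data.Nat as ℕ using (ℕ; zero; suc)
open import Data.Fin using (Fin; zero; suc)
open import Data.Bool using (Bool; true; false; _∧_; _∨_)
open import Data.Product using (∃; _×_; _,_)
open import Relation.Nullary using (¬_; does)
open import Relation.Binary.Definitions using (Decidable)
open import Relation.Binary.PropositionalEquality using (_≡_)

record FiniteField : Set₁ where
  field
    commRing : CommutativeRing 0ℓ 0ℓ
  open CommutativeRing commRing public
  field
    0≉1       : ¬ (0# ≈ 1#)
    inverse   : ∀ x → ¬ (x ≈ 0#) → ∃ λ y → x * y ≈ 1#
    _≟_       : Decidable _≈_
    size      : ℕ
    enum      : Fin size → Carrier
    enum-inj  : ∀ i j → enum i ≈ enum j → i ≡ j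
    enum-surj : ∀ x → ∃ λ i → enum i ≈ x

countFin : ∀ {m} → (Fin m → Bool) → ℕ
countFin {zero}  P = 0
countFin {suc m} P = if′ (P zero) ℕ.+ countFin (λ i → P (suc i))
  where
  if′ : Bool → ℕ
  if′ true  = 1
  if′ false = 0

sumFin : ∀ {m} → (Fin m → ℕ) → ℕ
sumFin {zero}  f = 0
sumFin {suc m} f = f zero ℕ.+ sumFin (λ i → f (suc i))

anyFin : ∀ {m} → (Fin m → Bool) → Bool
anyFin {zero}  P = false
anyFin {suc m} P = P zero ∨ anyFin (λ i → P (suc i))

module _ (K : FiniteField) where
  open FiniteField K hiding (zero)

  _^ᶠ_ : Carrier → ℕ → Carrier
  x ^ᶠ zero  = 1#
  x ^ᶠ suc n = x * (x ^ᶠ n)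

  -- x ∈ F_{q^k}  (the subfield of K fixed by x ↦ x^{q^k})
  InSubfield : ℕ → ℕ → Carrier → Set
  InSubfield q k x = x ^ᶠ (q ℕ.^ k) ≈ x

  inSubfield? : ℕ → ℕ → Carrier → Bool
  inSubfield? q k x = does ((x ^ᶠ (q ℕ.^ k)) ≟ x)

  Tr : ℕ → ℕ → Carrier → Carrier
  Tr q zero    x = 0#
  Tr q (suc i) x = Tr q i x + x ^ᶠ (q ℕ.^ i)

  inS? : ℕ → ℕ → Carrier → Carrier → Bool
  inS? q t ξ x = anyFin λ i →
    inSubfield? q t (enum i) ∧ does (x ≟ (enum i + ξ * Tr q t (enum i)))

  InS : ℕ → ℕ → Carrier → Carrier → Set
  InS q t ξ x = ∃ λ u → InSubfield q t u × x ≈ u + ξ * Tr q t u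

  -- ⟨(1,α)⟩_{F_{q^n}} ∈ L_U for U = S_{Tr,ξ} × S_{Tr,ξ}: some nonzero
  -- (x,y) ∈ U lies on ⟨(1,α)⟩, i.e. y = α x
  InL : ℕ → ℕ → Carrier → Carrier → Set
  InL q t ξ α = ∃ λ x → ∃ λ y →
    InS q t ξ x × InS q t ξ y × ¬ (x ≈ 0# × y ≈ 0#) × y ≈ α * x

  pointCount : ℕ → ℕ → Carrier → Carrier → ℕ
  pointCount q t ξ α = sumFin λ i → countFin λ j →
    inS? q t ξ (enum i) ∧ inS? q t ξ (enum j) ∧ does (enum j ≟ (α * enum i))

  -- w_L(⟨(1,α)⟩) = w  :⇔  dim_{F_q}(U ∩ ⟨(1,α)⟩) = w  ⇔  |U ∩ ⟨(1,α)⟩| = q^w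
  WeightIs : ℕ → ℕ → Carrier → Carrier → ℕ → Set
  WeightIs q t ξ α w = pointCount q t ξ α ≡ q ℕ.^ w

-- Write S = {u + ξ Tr u : u ∈ F_{q^t}} and W_α = {x ∈ S : α x ∈ S}; the weight of ⟨(1,α)⟩ is w
-- exactly when |W_α| = q^w. As {1, ξ} is an F_{q^t}-basis of K, every x ∈ S comes from a unique u.
-- If α ∈ F_q, then W_α = S, a copy of F_{q^t}. If α ∈ F_{q^t} \ F_q, comparing coordinates of α x
-- forces Tr u = 0 and Tr (α u) = 0, so W_α is the common kernel of two independent F_q-linear forms
-- on F_{q^t}. If α ∉ F_{q^t}, write α = a + b ξ with b ≠ 0: expanding α x with ξ² = A ξ + B shows
-- that u is determined by (Tr (a u), Tr u) ∈ F_q², which solves a linear system over F_q that is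
-- nonzero because Tr A ≠ -2; so W_α, which has a nonzero point as ⟨(1,α)⟩ ∈ L, is an F_q-line.
-- The subfield sizes |F_{q^k}| = q^k come from counting: x ↦ x^Q - x has at most Q roots, and its
-- image lies in the kernel of the trace, which has at most |K| / Q elements.

module Submission where

open import Defs
open import Algebra.Bundles using (CommutativeRing; RawRing)
open import Data.Nat as ℕ using (ℕ; zero; suc; _≤_; _<_; z≤n; s≤s)
import Data.Nat.Properties as ℕP
open import Data.Nat.Combinatorics using (_C_; nC1≡n; nCn≡1; nCk+nC[k+1]≡[n+1]C[k+1])
open import Data.Nat.Combinatorics.Specification using (k>n⇒nCk≡0)
open import Data.Nat.Divisibility using (_∣_; divides; ∣⇒≤)
open import Data.Nat.Primality using (Prime; euclidsLemma; prime⇒nonTrivial)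
open import Data.Nat.Tactic.RingSolver using (solve-∀)
open import Data.Fin using (Fin; zero; suc; toℕ; fromℕ)
import Data.Fin.Properties as FinP
open import Data.Fin.Permutation using (Permutation; permutation; _⟨$⟩ʳ_)
open import Data.Vec using (Vec; []; _∷_; zipWith; map)
open import Data.Bool using (Bool; true; false; _∧_; not; T; if_then_else_)
open import Data.Bool.Properties using (T-∧)
open import Data.Maybe using (Maybe; just; nothing)
open import Data.Product using (∃; _×_; _,_; proj₁; proj₂)
open import Data.Sum using (_⊎_; inj₁; inj₂)
open import Data.Empty using (⊥; ⊥-elim)
open import Function using (_∘_)
open import Function.Bundles using (Equivalence)
open import Relation.Nullary using (¬_; Dec; yes; no; does)
open import Relation.Binary.Definitions using (_Respects_)
open import Relation.Binary.PropositionalEquality as ≡ using (_≡_; refl; cong; cong₂)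
open import Algebra.Solver.Ring.AlmostCommutativeRing using (fromCommutativeRing; _-Raw-AlmostCommutative⟶_)
import Algebra.Solver.Ring as RingSolver
import Algebra.Solver.CommutativeMonoid as CommutativeMonoidSolver
import Algebra.Properties.AbelianGroup as AbelianGroupProperties
import Algebra.Properties.Group as GroupProperties
import Algebra.Properties.Ring as RingProperties
import Algebra.Properties.Semiring.Mult as SemiringMult
import Algebra.Properties.Monoid.Mult as MonoidMult
import Algebra.Properties.Semiring.Exp as SemiringExp
import Algebra.Properties.CommutativeSemiring.Binomial as Binomial
import Algebra.Properties.CommutativeMonoid.Sum as CommutativeMonoidSum
import Algebra.Properties.Semiring.Sum as SemiringSum
import Relation.Binary.Reasoning.Setoid as SetoidReasoning

open Equivalence using (to; from)
open CommutativeMonoidSum ℕP.+-0-commutativeMonoid using (sum; sum-cong-≗; ∑-comm; ∑-distrib-+)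
open SemiringSum ℕP.+-*-semiring using (*-distribˡ-sum)

iverson : Bool → ℕ
iverson false = 0
iverson true  = 1

sumFin≡sum : ∀ {m} (f : Fin m → ℕ) → sumFin f ≡ sum f
sumFin≡sum {zero}  f = refl
sumFin≡sum {suc m} f = cong (f zero ℕ.+_) (sumFin≡sum (f ∘ suc))

countFin≡sum : ∀ {m} (P : Fin m → Bool) → countFin P ≡ sum (iverson ∘ P)
countFin≡sum {zero}  P = refl
countFin≡sum {suc m} P with P zero
... | true  = cong suc (countFin≡sum (P ∘ suc))
... | false = countFin≡sum (P ∘ suc)

sum-mono-≤ : ∀ {m} {f g : Fin m → ℕ} → (∀ i → f i ≤ g i) → sum f ≤ sum g
sum-mono-≤ {zero}  f≤g = z≤n
sum-mono-≤ {suc m} f≤g = ℕP.+-mono-≤ (f≤g zero) (sum-mono-≤ (f≤g ∘ suc))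

countFin-none : ∀ {m} (P : Fin m → Bool) → (∀ i → ¬ T (P i)) → countFin P ≡ 0
countFin-none {zero}  P ¬P = refl
countFin-none {suc m} P ¬P with P zero | ¬P zero
... | false | _  = countFin-none (P ∘ suc) (¬P ∘ suc)
... | true  | ¬t = ⊥-elim (¬t _)

countFin-unique : ∀ {m} (P : Fin m → Bool) (i : Fin m) → T (P i) →
                  (∀ j → T (P j) → j ≡ i) → countFin P ≡ 1
countFin-unique {suc m} P zero Pi unique with P zero
... | true = cong suc (countFin-none (P ∘ suc) (λ j Pj → FinP.0≢1+n (≡.sym (unique (suc j) Pj))))
countFin-unique {suc m} P (suc i) Pi unique with P zero | unique zero
... | false | _ = countFin-unique (P ∘ suc) i Pi (λ j Pj → FinP.suc-injective (unique (suc j) Pj))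
... | true  | zero≡suc = ⊥-elim (FinP.0≢1+n (zero≡suc _))

anyFin⇒∃ : ∀ {m} (P : Fin m → Bool) → T (anyFin P) → ∃ λ i → T (P i)
anyFin⇒∃ {suc m} P any with P zero in eq
... | true  = zero , ≡.subst T (≡.sym eq) _
... | false with anyFin⇒∃ (P ∘ suc) any
...   | i , Pi = suc i , Pi

∃⇒anyFin : ∀ {m} (P : Fin m → Bool) (i : Fin m) → T (P i) → T (anyFin P)
∃⇒anyFin {suc m} P zero    Pi with P zero
... | true = _
∃⇒anyFin {suc m} P (suc i) Pi with P zero
... | true  = _
... | false = ∃⇒anyFin (P ∘ suc) i Pi

countFin-not : ∀ {m} (P : Fin m → Bool) → countFin (not ∘ P) ℕ.+ countFin P ≡ m
countFin-not {zero}  P = refl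
countFin-not {suc m} P with P zero
... | true  = ≡.trans (ℕP.+-suc _ _) (cong suc (countFin-not (P ∘ suc)))
... | false = cong suc (countFin-not (P ∘ suc))

-- Binomial coefficients

C-absorption : ∀ n k → suc k ℕ.* (suc n C suc k) ≡ suc n ℕ.* (n C k)
C-absorption zero    zero    = refl
C-absorption zero    (suc k) rewrite k>n⇒nCk≡0 {1} {suc (suc k)} (s≤s (s≤s z≤n))
                                   | k>n⇒nCk≡0 {0} {suc k} (s≤s z≤n) = ℕP.*-zeroʳ (suc (suc k))
C-absorption (suc n) zero    = ≡.trans (ℕP.+-identityʳ _) (≡.trans (nC1≡n (suc (suc n))) (≡.sym (ℕP.*-identityʳ _)))
C-absorption (suc n) (suc k) = begin
  suc (suc k) ℕ.* (suc (suc n) C suc (suc k))             ≡⟨ cong (suc (suc k) ℕ.*_) (nCk+nC[k+1]≡[n+1]C[k+1] (suc n) (suc k)) ⟨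
  suc (suc k) ℕ.* (A ℕ.+ B)                               ≡⟨ expand k A B ⟩
  A ℕ.+ (suc k ℕ.* A ℕ.+ suc (suc k) ℕ.* B)               ≡⟨ cong (A ℕ.+_) (cong₂ ℕ._+_ (C-absorption n k) (C-absorption n (suc k))) ⟩
  A ℕ.+ (suc n ℕ.* (n C k) ℕ.+ suc n ℕ.* (n C suc k))     ≡⟨ cong (A ℕ.+_) (ℕP.*-distribˡ-+ (suc n) (n C k) (n C suc k)) ⟨
  A ℕ.+ suc n ℕ.* (n C k ℕ.+ n C suc k)                   ≡⟨ cong (λ z → A ℕ.+ suc n ℕ.* z) (nCk+nC[k+1]≡[n+1]C[k+1] n k) ⟩
  suc (suc n) ℕ.* A                                       ∎
  where
  open ≡.≡-Reasoning
  A = suc n C suc k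
  B = suc n C suc (suc k)
  expand : ∀ k A B → suc (suc k) ℕ.* (A ℕ.+ B) ≡ A ℕ.+ (suc k ℕ.* A ℕ.+ suc (suc k) ℕ.* B)
  expand = solve-∀

prime∣pCk : ∀ {p k} → Prime p → 0 < k → k < p → p ∣ p C k
prime∣pCk {suc n} {suc k} p-prime _ k<p
  with euclidsLemma (suc k) (suc n C suc k) p-prime
         (divides (n C k) (≡.trans (C-absorption n k) (ℕP.*-comm (suc n) (n C k))))
... | inj₂ p∣pCk = p∣pCk
... | inj₁ p∣k+1 = ⊥-elim (ℕP.<⇒≱ k<p (∣⇒≤ p∣k+1))

module IntegerCoefficientRingSolver {c ℓ} (R : CommutativeRing c ℓ) where
  open CommutativeRing R renaming (refl to ≈-refl; sym to ≈-sym; trans to ≈-trans; reflexive to ≡⇒≈)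
  open SemiringMult semiring using (×1-homo-*)
  open MonoidMult +-monoid using (×-homo-+) renaming (_×_ to _×ᴿ_)
  open AbelianGroupProperties +-abelianGroup using (⁻¹-anti-homo‿-; ⁻¹-∙-comm)
  open GroupProperties +-group using (x∙y⁻¹≈ε⇒x≈y; x≈y⇒x∙y⁻¹≈ε)
  open RingProperties ring using (x[y-z]≈xy-xz; [y-z]x≈yx-zx; -0#≈0#)
  open CommutativeMonoidSolver +-commutativeMonoid using (_⊕_; _⊜_; solve)
  open SetoidReasoning setoid

  -- Integer coefficients as pairs (m , n) ↦ m - n: their equality is decided by computing in ℕ,
  -- which the solver needs and the carrier of R does not offer.
  ℤ-rawRing : RawRing _ _
  ℤ-rawRing = record
    { Carrier = ℕ × ℕ
    ; _≈_     = _≡_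
    ; _+_     = λ { (a , b) (c , d) → a ℕ.+ c , b ℕ.+ d }
    ; _*_     = λ { (a , b) (c , d) → a ℕ.* c ℕ.+ b ℕ.* d , a ℕ.* d ℕ.+ b ℕ.* c }
    ; -_      = λ { (a , b) → b , a }
    ; 0#      = 0 , 0
    ; 1#      = 1 , 0
    }

  ⟨_⟩ : ℕ → Carrier
  ⟨ n ⟩ = n ×ᴿ 1#

  ⟦_⟧ : ℕ × ℕ → Carrier
  ⟦ m , n ⟧ = ⟨ m ⟩ - ⟨ n ⟩

  -+--interchange : ∀ x y z w → (x - y) + (z - w) ≈ (x + z) - (y + w)
  -+--interchange x y z w = begin
    (x - y) + (z - w)       ≈⟨ solve 4 (λ x y z w → (x ⊕ y) ⊕ (z ⊕ w) ⊜ (x ⊕ z) ⊕ (y ⊕ w)) ≈-refl x (- y) z (- w) ⟩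
    (x + z) + (- y + - w)   ≈⟨ +-congˡ (⁻¹-∙-comm y w) ⟩
    (x + z) - (y + w)       ∎

  -*--expand : ∀ x y z w → (x - y) * (z - w) ≈ (x * z + y * w) - (x * w + y * z)
  -*--expand x y z w = begin
    (x - y) * (z - w)                   ≈⟨ [y-z]x≈yx-zx (z - w) x y ⟩
    x * (z - w) - y * (z - w)           ≈⟨ +-cong (x[y-z]≈xy-xz x z w) (-‿cong (x[y-z]≈xy-xz y z w)) ⟩
    (x * z - x * w) - (y * z - y * w)   ≈⟨ +-congˡ (⁻¹-anti-homo‿- (y * z) (y * w)) ⟩
    (x * z - x * w) + (y * w - y * z)   ≈⟨ -+--interchange (x * z) (x * w) (y * w) (y * z) ⟩
    (x * z + y * w) - (x * w + y * z)   ∎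

  homomorphism : ℤ-rawRing -Raw-AlmostCommutative⟶ fromCommutativeRing R
  homomorphism = record
    { ⟦_⟧    = ⟦_⟧
    ; +-homo = λ { (a , b) (c , d) → begin
        ⟨ a ℕ.+ c ⟩ - ⟨ b ℕ.+ d ⟩               ≈⟨ +-cong (×-homo-+ 1# a c) (-‿cong (×-homo-+ 1# b d)) ⟩
        (⟨ a ⟩ + ⟨ c ⟩) - (⟨ b ⟩ + ⟨ d ⟩)         ≈⟨ -+--interchange _ _ _ _ ⟨
        (⟨ a ⟩ - ⟨ b ⟩) + (⟨ c ⟩ - ⟨ d ⟩)         ∎ }
    ; *-homo = λ { (a , b) (c , d) → begin
        ⟨ a ℕ.* c ℕ.+ b ℕ.* d ⟩ - ⟨ a ℕ.* d ℕ.+ b ℕ.* c ⟩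
          ≈⟨ +-cong (×-homo-+ 1# (a ℕ.* c) (b ℕ.* d)) (-‿cong (×-homo-+ 1# (a ℕ.* d) (b ℕ.* c))) ⟩
        (⟨ a ℕ.* c ⟩ + ⟨ b ℕ.* d ⟩) - (⟨ a ℕ.* d ⟩ + ⟨ b ℕ.* c ⟩)
          ≈⟨ +-cong (+-cong (×1-homo-* a c) (×1-homo-* b d)) (-‿cong (+-cong (×1-homo-* a d) (×1-homo-* b c))) ⟩
        (⟨ a ⟩ * ⟨ c ⟩ + ⟨ b ⟩ * ⟨ d ⟩) - (⟨ a ⟩ * ⟨ d ⟩ + ⟨ b ⟩ * ⟨ c ⟩)
          ≈⟨ -*--expand _ _ _ _ ⟨
        (⟨ a ⟩ - ⟨ b ⟩) * (⟨ c ⟩ - ⟨ d ⟩) ∎ }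
    ; -‿homo = λ { (a , b) → ≈-sym (⁻¹-anti-homo‿- ⟨ a ⟩ ⟨ b ⟩) }
    ; 0-homo = -‿inverseʳ 0#
    ; 1-homo = ≈-trans (+-congˡ -0#≈0#) (≈-trans (+-identityʳ _) (+-identityʳ 1#))
    }

  _≟ℤ_ : ∀ x y → Maybe (⟦ x ⟧ ≈ ⟦ y ⟧)
  (a , b) ≟ℤ (c , d) with a ℕ.+ d ℕP.≟ c ℕ.+ b
  ... | no _      = nothing
  ... | yes a+d≡c+b = just (x∙y⁻¹≈ε⇒x≈y _ _ (begin
    (⟨ a ⟩ - ⟨ b ⟩) - (⟨ c ⟩ - ⟨ d ⟩)    ≈⟨ +-congˡ (⁻¹-anti-homo‿- ⟨ c ⟩ ⟨ d ⟩) ⟩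
    (⟨ a ⟩ - ⟨ b ⟩) + (⟨ d ⟩ - ⟨ c ⟩)    ≈⟨ -+--interchange _ _ _ _ ⟩
    (⟨ a ⟩ + ⟨ d ⟩) - (⟨ b ⟩ + ⟨ c ⟩)    ≈⟨ +-cong (≈-sym (×-homo-+ 1# a d)) (-‿cong (+-comm _ _)) ⟩
    ⟨ a ℕ.+ d ⟩ - (⟨ c ⟩ + ⟨ b ⟩)        ≈⟨ +-congʳ (≡⇒≈ (≡.cong ⟨_⟩ a+d≡c+b)) ⟩
    ⟨ c ℕ.+ b ⟩ - (⟨ c ⟩ + ⟨ b ⟩)        ≈⟨ x≈y⇒x∙y⁻¹≈ε (×-homo-+ 1# c b) ⟩
    0#                                   ∎))

  open RingSolver ℤ-rawRing (fromCommutativeRing R) homomorphism _≟ℤ_ public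
    using (solve; _:=_; _:+_; _:*_; _:-_; :-_)

module FiniteFieldTheory (K : FiniteField) where
  open FiniteField K public hiding (zero)
    renaming (refl to ≈-refl; sym to ≈-sym; trans to ≈-trans; reflexive to ≡⇒≈)
  open IntegerCoefficientRingSolver commRing public using (⟨_⟩; solve; _:=_; _:+_; _:*_; _:-_; :-_)
  open SemiringMult semiring using (×1-homo-*)
  open RingProperties ring public using (-‿distribʳ-*; -‿+-comm; -0#≈0#)
  open GroupProperties +-group public using (x∙y⁻¹≈ε⇒x≈y; x≈y⇒x∙y⁻¹≈ε)
  module ≈-Reasoning = SetoidReasoning setoid

  infixr 8 _^_
  _^_ : Carrier → ℕ → Carrier
  x ^ n = _^ᶠ_ K x n

  infix 4 _≈ᵇ_
  _≈ᵇ_ : Carrier → Carrier → Bool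
  x ≈ᵇ y = does (x ≟ y)

  ≈ᵇ⇒≈ : ∀ {x y} → T (x ≈ᵇ y) → x ≈ y
  ≈ᵇ⇒≈ {x} {y} _ with x ≟ y
  ... | yes x≈y = x≈y

  ≈⇒≈ᵇ : ∀ {x y} → x ≈ y → T (x ≈ᵇ y)
  ≈⇒≈ᵇ {x} {y} x≈y with x ≟ y
  ... | yes _   = _
  ... | no x≉y = x≉y x≈y

  ≉⇒not-≈ᵇ : ∀ {x y} → ¬ x ≈ y → T (not (x ≈ᵇ y))
  ≉⇒not-≈ᵇ {x} {y} x≉y with x ≟ y
  ... | yes x≈y = x≉y x≈y
  ... | no _    = _

  not-≈ᵇ⇒≉ : ∀ {x y} → T (not (x ≈ᵇ y)) → ¬ x ≈ y
  not-≈ᵇ⇒≉ {x} {y} x≉ᵇy x≈y with x ≟ y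
  ... | yes _   = x≉ᵇy
  ... | no x≉y = x≉y x≈y

  x-y≈0⇒x≈y : ∀ {x y} → x - y ≈ 0# → x ≈ y
  x-y≈0⇒x≈y = x∙y⁻¹≈ε⇒x≈y _ _

  x*y≈0⇒x≈0⊎y≈0 : ∀ {x y} → x * y ≈ 0# → x ≈ 0# ⊎ y ≈ 0#
  x*y≈0⇒x≈0⊎y≈0 {x} {y} xy≈0 with x ≟ 0#
  ... | yes x≈0 = inj₁ x≈0
  ... | no x≉0 with inverse x x≉0
  ...   | x⁻¹ , xx⁻¹≈1 = inj₂ (begin
          y                 ≈⟨ *-identityˡ y ⟨
          1# * y            ≈⟨ *-congʳ xx⁻¹≈1 ⟨
          (x * x⁻¹) * y     ≈⟨ solve 3 (λ x x⁻¹ y → (x :* x⁻¹) :* y := x⁻¹ :* (x :* y)) ≈-refl x x⁻¹ y ⟩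
          x⁻¹ * (x * y)     ≈⟨ *-congˡ xy≈0 ⟩
          x⁻¹ * 0#          ≈⟨ zeroʳ x⁻¹ ⟩
          0#                ∎)
    where open ≈-Reasoning

  x≉0∧y≉0⇒x*y≉0 : ∀ {x y} → ¬ x ≈ 0# → ¬ y ≈ 0# → ¬ x * y ≈ 0#
  x≉0∧y≉0⇒x*y≉0 x≉0 y≉0 xy≈0 with x*y≈0⇒x≈0⊎y≈0 xy≈0
  ... | inj₁ x≈0 = x≉0 x≈0
  ... | inj₂ y≈0 = y≉0 y≈0

  infix 9 _⁻¹
  _⁻¹ : Carrier → Carrier
  x ⁻¹ with x ≟ 0#
  ... | yes _   = 0#
  ... | no x≉0 = proj₁ (inverse x x≉0)

  x*x⁻¹≈1 : ∀ {x} → ¬ x ≈ 0# → x * x ⁻¹ ≈ 1#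
  x*x⁻¹≈1 {x} x≉0 with x ≟ 0#
  ... | yes x≈0 = ⊥-elim (x≉0 x≈0)
  ... | no x≉0′ = proj₂ (inverse x x≉0′)

  x⁻¹*x≈1 : ∀ {x} → ¬ x ≈ 0# → x ⁻¹ * x ≈ 1#
  x⁻¹*x≈1 x≉0 = ≈-trans (*-comm _ _) (x*x⁻¹≈1 x≉0)

  x≈0⇒x⁻¹≈0 : ∀ {x} → x ≈ 0# → x ⁻¹ ≈ 0#
  x≈0⇒x⁻¹≈0 {x} x≈0 with x ≟ 0#
  ... | yes _   = ≈-refl
  ... | no x≉0 = ⊥-elim (x≉0 x≈0)

  ⁻¹-unique : ∀ {x y} → x * y ≈ 1# → x ⁻¹ ≈ y
  ⁻¹-unique {x} {y} xy≈1 = begin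
    x ⁻¹               ≈⟨ *-identityʳ _ ⟨
    x ⁻¹ * 1#          ≈⟨ *-congˡ xy≈1 ⟨
    x ⁻¹ * (x * y)     ≈⟨ *-assoc _ _ _ ⟨
    (x ⁻¹ * x) * y     ≈⟨ *-congʳ (x⁻¹*x≈1 x≉0) ⟩
    1# * y             ≈⟨ *-identityˡ y ⟩
    y                  ∎
    where
    open ≈-Reasoning
    x≉0 : ¬ x ≈ 0#
    x≉0 x≈0 = 0≉1 (≈-trans (≈-sym (≈-trans (*-congʳ x≈0) (zeroˡ y))) xy≈1)

  ⁻¹-cong : ∀ {x y} → x ≈ y → x ⁻¹ ≈ y ⁻¹
  ⁻¹-cong {x} {y} x≈y = by-cases (y ≟ 0#)
    where
    by-cases : Dec (y ≈ 0#) → x ⁻¹ ≈ y ⁻¹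
    by-cases (yes y≈0) = ≈-trans (x≈0⇒x⁻¹≈0 (≈-trans x≈y y≈0)) (≈-sym (x≈0⇒x⁻¹≈0 y≈0))
    by-cases (no y≉0)  = ⁻¹-unique (≈-trans (*-congʳ x≈y) (x*x⁻¹≈1 y≉0))

  x≉0⇒x⁻¹≉0 : ∀ {x} → ¬ x ≈ 0# → ¬ x ⁻¹ ≈ 0#
  x≉0⇒x⁻¹≉0 x≉0 x⁻¹≈0 = 0≉1 (≈-trans (≈-sym (≈-trans (*-congˡ x⁻¹≈0) (zeroʳ _))) (x*x⁻¹≈1 x≉0))

  *-cancelʳ : ∀ {x y z} → ¬ z ≈ 0# → x * z ≈ y * z → x ≈ y
  *-cancelʳ {x} {y} {z} z≉0 xz≈yz = begin
    x                  ≈⟨ *-identityʳ x ⟨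
    x * 1#             ≈⟨ *-congˡ (x*x⁻¹≈1 z≉0) ⟨
    x * (z * z ⁻¹)     ≈⟨ *-assoc x z _ ⟨
    (x * z) * z ⁻¹     ≈⟨ *-congʳ xz≈yz ⟩
    (y * z) * z ⁻¹     ≈⟨ *-assoc y z _ ⟩
    y * (z * z ⁻¹)     ≈⟨ *-congˡ (x*x⁻¹≈1 z≉0) ⟩
    y * 1#             ≈⟨ *-identityʳ y ⟩
    y                  ∎
    where open ≈-Reasoning

  solutions-parallel : ∀ {ρ₁ ρ₂ s τ s₀ τ₀} → ¬ (ρ₁ ≈ 0# × ρ₂ ≈ 0#) →
                       ρ₁ * s + ρ₂ * τ ≈ 0# → ρ₁ * s₀ + ρ₂ * τ₀ ≈ 0# → s * τ₀ ≈ τ * s₀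
  solutions-parallel {ρ₁} {ρ₂} {s} {τ} {s₀} {τ₀} ρ≉0 ρ·v≈0 ρ·v₀≈0 with (s * τ₀ - τ * s₀) ≟ 0#
  ... | yes det≈0 = x-y≈0⇒x≈y det≈0
  ... | no det≉0  = ⊥-elim (ρ≉0 (cancel ρ₁*det≈0 , cancel ρ₂*det≈0))
    where
    open ≈-Reasoning
    cancel : ∀ {ρ} → ρ * (s * τ₀ - τ * s₀) ≈ 0# → ρ ≈ 0#
    cancel ρ*det≈0 with x*y≈0⇒x≈0⊎y≈0 ρ*det≈0
    ... | inj₁ ρ≈0   = ρ≈0
    ... | inj₂ det≈0 = ⊥-elim (det≉0 det≈0)
    combination≈0 : ∀ {x y a b} → a ≈ 0# → b ≈ 0# → x * a - y * b ≈ 0#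
    combination≈0 {x} {y} {a} {b} a≈0 b≈0 = begin
      x * a - y * b     ≈⟨ +-cong (*-congˡ a≈0) (-‿cong (*-congˡ b≈0)) ⟩
      x * 0# - y * 0#   ≈⟨ +-cong (zeroʳ x) (-‿cong (zeroʳ y)) ⟩
      0# - 0#           ≈⟨ -‿inverseʳ 0# ⟩
      0#                ∎
    ρ₁*det≈0 : ρ₁ * (s * τ₀ - τ * s₀) ≈ 0#
    ρ₁*det≈0 = ≈-trans
      (solve 6 (λ ρ₁ ρ₂ s τ s₀ τ₀ → ρ₁ :* (s :* τ₀ :- τ :* s₀) := τ₀ :* (ρ₁ :* s :+ ρ₂ :* τ) :- τ :* (ρ₁ :* s₀ :+ ρ₂ :* τ₀))
        ≈-refl ρ₁ ρ₂ s τ s₀ τ₀)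
      (combination≈0 ρ·v≈0 ρ·v₀≈0)
    ρ₂*det≈0 : ρ₂ * (s * τ₀ - τ * s₀) ≈ 0#
    ρ₂*det≈0 = ≈-trans
      (solve 6 (λ ρ₁ ρ₂ s τ s₀ τ₀ → ρ₂ :* (s :* τ₀ :- τ :* s₀) := s :* (ρ₁ :* s₀ :+ ρ₂ :* τ₀) :- s₀ :* (ρ₁ :* s :+ ρ₂ :* τ))
        ≈-refl ρ₁ ρ₂ s τ s₀ τ₀)
      (combination≈0 ρ·v₀≈0 ρ·v≈0)

  parallel⇒multiple : ∀ {x y x₀ y₀} → ¬ x₀ ≈ 0# → x * y₀ ≈ y * x₀ →
                      x ≈ (x * x₀ ⁻¹) * x₀ × y ≈ (x * x₀ ⁻¹) * y₀
  parallel⇒multiple {x} {y} {x₀} {y₀} x₀≉0 xy₀≈yx₀ =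
    (begin
      x                      ≈⟨ *-identityʳ x ⟨
      x * 1#                 ≈⟨ *-congˡ (x⁻¹*x≈1 x₀≉0) ⟨
      x * (x₀ ⁻¹ * x₀)       ≈⟨ *-assoc _ _ _ ⟨
      (x * x₀ ⁻¹) * x₀       ∎) ,
    (begin
      y                      ≈⟨ *-identityʳ y ⟨
      y * 1#                 ≈⟨ *-congˡ (x*x⁻¹≈1 x₀≉0) ⟨
      y * (x₀ * x₀ ⁻¹)       ≈⟨ *-assoc _ _ _ ⟨
      (y * x₀) * x₀ ⁻¹       ≈⟨ *-congʳ xy₀≈yx₀ ⟨
      (x * y₀) * x₀ ⁻¹       ≈⟨ solve 3 (λ x y₀ i → (x :* y₀) :* i := (x :* i) :* y₀) ≈-refl x y₀ (x₀ ⁻¹) ⟩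
      (x * x₀ ⁻¹) * y₀       ∎)
    where open ≈-Reasoning

  module Exp = SemiringExp semiring

  ^≈^ : ∀ x n → x ^ n ≈ x Exp.^ n
  ^≈^ x zero    = ≈-refl
  ^≈^ x (suc n) = *-congˡ (^≈^ x n)

  ^-congˡ : ∀ n {x y} → x ≈ y → x ^ n ≈ y ^ n
  ^-congˡ n {x} {y} x≈y = ≈-trans (^≈^ x n) (≈-trans (Exp.^-congˡ n x≈y) (≈-sym (^≈^ y n)))

  ^-assocʳ : ∀ x m n → (x ^ m) ^ n ≈ x ^ (m ℕ.* n)
  ^-assocʳ x m n = begin
    (x ^ m) ^ n          ≈⟨ ^≈^ (x ^ m) n ⟩
    (x ^ m) Exp.^ n      ≈⟨ Exp.^-congˡ n (^≈^ x m) ⟩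
    (x Exp.^ m) Exp.^ n  ≈⟨ Exp.^-assocʳ x m n ⟩
    x Exp.^ (m ℕ.* n)    ≈⟨ ^≈^ x (m ℕ.* n) ⟨
    x ^ (m ℕ.* n)        ∎
    where open ≈-Reasoning

  ^-distrib-* : ∀ x y n → (x * y) ^ n ≈ x ^ n * y ^ n
  ^-distrib-* x y zero    = ≈-sym (*-identityʳ 1#)
  ^-distrib-* x y (suc n) = ≈-trans (*-congˡ (^-distrib-* x y n))
    (solve 4 (λ x y X Y → (x :* y) :* (X :* Y) := (x :* X) :* (y :* Y)) ≈-refl x y (x ^ n) (y ^ n))

  1^n≈1 : ∀ n → 1# ^ n ≈ 1#
  1^n≈1 zero    = ≈-refl
  1^n≈1 (suc n) = ≈-trans (*-identityˡ _) (1^n≈1 n)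

  0^n≈0 : ∀ {n} → 1 ≤ n → 0# ^ n ≈ 0#
  0^n≈0 (s≤s _) = zeroˡ _

  x^1≈x : ∀ x → x ^ 1 ≈ x
  x^1≈x = *-identityʳ

  x≉0⇒x^n≉0 : ∀ {x} n → ¬ x ≈ 0# → ¬ x ^ n ≈ 0#
  x≉0⇒x^n≉0 zero    x≉0 1≈0 = 0≉1 (≈-sym 1≈0)
  x≉0⇒x^n≉0 (suc n) x≉0     = x≉0∧y≉0⇒x*y≉0 x≉0 (x≉0⇒x^n≉0 n x≉0)

  x^n≈0⇒x≈0 : ∀ {x} n → x ^ n ≈ 0# → x ≈ 0#
  x^n≈0⇒x≈0 {x} n xⁿ≈0 with x ≟ 0#
  ... | yes x≈0 = x≈0
  ... | no x≉0  = ⊥-elim (x≉0⇒x^n≉0 n x≉0 xⁿ≈0)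

  ⁻¹-^ : ∀ x n → (x ⁻¹) ^ n ≈ (x ^ n) ⁻¹
  ⁻¹-^ x zero    = ≈-sym (⁻¹-unique (*-identityˡ 1#))
  ⁻¹-^ x (suc n) = by-cases (x ≟ 0#)
    where
    by-cases : Dec (x ≈ 0#) → (x ⁻¹) ^ suc n ≈ (x ^ suc n) ⁻¹
    by-cases (yes x≈0) = ≈-trans (≈-trans (*-congʳ (x≈0⇒x⁻¹≈0 x≈0)) (zeroˡ _))
                                 (≈-sym (x≈0⇒x⁻¹≈0 (≈-trans (*-congʳ x≈0) (zeroˡ _))))
    by-cases (no x≉0)  = ≈-sym (⁻¹-unique (≈-trans (≈-sym (^-distrib-* x (x ⁻¹) (suc n)))
                                 (≈-trans (^-congˡ (suc n) (x*x⁻¹≈1 x≉0)) (1^n≈1 (suc n)))))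

  -- Counting elements of K

  Pred : Set
  Pred = Carrier → Bool

  Respects≈ : Pred → Set
  Respects≈ P = (T ∘ P) Respects _≈_

  Congruent : (Carrier → Carrier) → Set
  Congruent f = ∀ {x y} → x ≈ y → f x ≈ f y

  count : Pred → ℕ
  count P = countFin (P ∘ enum)

  index : Carrier → Fin size
  index x = proj₁ (enum-surj x)

  enum-index : ∀ x → enum (index x) ≈ x
  enum-index x = proj₂ (enum-surj x)

  iverson-mono : ∀ {a b} → (T a → T b) → iverson a ≤ iverson b
  iverson-mono {false}         _   = z≤n
  iverson-mono {true}  {true}  _   = ℕP.≤-refl
  iverson-mono {true}  {false} a⇒b = ⊥-elim (a⇒b _)

  count≡sum : ∀ P → count P ≡ sum (iverson ∘ P ∘ enum)
  count≡sum P = countFin≡sum (P ∘ enum)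

  count-mono : ∀ {P Q} → (∀ x → T (P x) → T (Q x)) → count P ≤ count Q
  count-mono {P} {Q} P⊆Q = begin
    count P                   ≡⟨ count≡sum P ⟩
    sum (iverson ∘ P ∘ enum)  ≤⟨ sum-mono-≤ (λ i → iverson-mono (P⊆Q (enum i))) ⟩
    sum (iverson ∘ Q ∘ enum)  ≡⟨ count≡sum Q ⟨
    count Q                   ∎
    where open ℕP.≤-Reasoning

  count-cong : ∀ {P Q} → (∀ x → T (P x) → T (Q x)) → (∀ x → T (Q x) → T (P x)) → count P ≡ count Q
  count-cong P⊆Q Q⊆P = ℕP.≤-antisym (count-mono P⊆Q) (count-mono Q⊆P)

  count-∪ : ∀ {P A B} → (∀ x → T (P x) → T (A x) ⊎ T (B x)) → count P ≤ count A ℕ.+ count B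
  count-∪ {P} {A} {B} P⊆A∪B = begin
    count P
      ≡⟨ count≡sum P ⟩
    sum (iverson ∘ P ∘ enum)
      ≤⟨ sum-mono-≤ (λ i → iverson-∪ (P⊆A∪B (enum i))) ⟩
    sum (λ i → iverson (A (enum i)) ℕ.+ iverson (B (enum i)))
                                                      ≡⟨ ∑-distrib-+ (iverson ∘ A ∘ enum) (iverson ∘ B ∘ enum) ⟩
    sum (iverson ∘ A ∘ enum) ℕ.+ sum (iverson ∘ B ∘ enum)
                                                      ≡⟨ cong₂ ℕ._+_ (count≡sum A) (count≡sum B) ⟨
    count A ℕ.+ count B ∎
    where
    open ℕP.≤-Reasoning
    iverson-∪ : ∀ {p a b} → (T p → T a ⊎ T b) → iverson p ≤ iverson a ℕ.+ iverson b
    iverson-∪ {false} _ = z≤n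
    iverson-∪ {true} {a} {b} p⇒a⊎b with p⇒a⊎b _
    ... | inj₁ ta = ℕP.≤-trans (iverson-mono {true} {a} (λ _ → ta)) (ℕP.m≤m+n (iverson a) (iverson b))
    ... | inj₂ tb = ℕP.≤-trans (iverson-mono {true} {b} (λ _ → tb)) (ℕP.m≤n+m (iverson b) (iverson a))

  count-none : ∀ {P} → (∀ x → ¬ T (P x)) → count P ≡ 0
  count-none {P} ¬P = countFin-none (P ∘ enum) (¬P ∘ enum)

  count-unique : ∀ {P} → Respects≈ P → ∀ {x} → T (P x) → (∀ y → T (P y) → y ≈ x) → count P ≡ 1
  count-unique {P} P-resp {x} Px unique = countFin-unique (P ∘ enum) (index x)
    (P-resp (≈-sym (enum-index x)) Px)
    (λ j Pj → enum-inj j (index x) (≈-trans (unique (enum j) Pj) (≈-sym (enum-index x))))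

  count-all : count (λ _ → true) ≡ size
  count-all = go size
    where
    go : ∀ m → countFin {m} (λ _ → true) ≡ m
    go zero    = refl
    go (suc m) = cong suc (go m)

  count-≈ᵇ : ∀ a → count (_≈ᵇ a) ≡ 1
  count-≈ᵇ a = count-unique (λ x≈y x≈a → ≈⇒≈ᵇ (≈-trans (≈-sym x≈y) (≈ᵇ⇒≈ x≈a))) (≈⇒≈ᵇ ≈-refl) (λ y → ≈ᵇ⇒≈)

  count-∧-≈ᵇ : ∀ {P} → Respects≈ P → ∀ z → count (λ y → P y ∧ (y ≈ᵇ z)) ≡ iverson (P z)
  count-∧-≈ᵇ {P} P-resp z with P z in Pz
  ... | true  = count-unique (λ y≈y′ Py∧y≈z → let (Py , y≈ᵇz) = to T-∧ Py∧y≈z in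
                  from T-∧ (P-resp y≈y′ Py , ≈⇒≈ᵇ (≈-trans (≈-sym y≈y′) (≈ᵇ⇒≈ y≈ᵇz))))
                (from T-∧ (≡.subst T (≡.sym Pz) _ , ≈⇒≈ᵇ ≈-refl))
                (λ y Py∧y≈z → ≈ᵇ⇒≈ (proj₂ (to T-∧ Py∧y≈z)))
  ... | false = count-none {λ y → P y ∧ (y ≈ᵇ z)} (λ y Py∧y≈z → let (Py , y≈ᵇz) = to T-∧ Py∧y≈z in
                  ≡.subst T Pz (P-resp (≈ᵇ⇒≈ y≈ᵇz) Py))

  fibre : Pred → (Carrier → Carrier) → Carrier → Pred
  fibre D f y x = D x ∧ (f x ≈ᵇ y)

  fibre-resp : ∀ {D f} → Respects≈ D → Congruent f → ∀ y → Respects≈ (fibre D f y)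
  fibre-resp D-resp f-cong y x≈x′ Dx∧fx≈y with to T-∧ Dx∧fx≈y
  ... | Dx , fx≈y = from T-∧ (D-resp x≈x′ Dx , ≈⇒≈ᵇ (≈-trans (≈-sym (f-cong x≈x′)) (≈ᵇ⇒≈ fx≈y)))

  count-fibres : ∀ D f → count D ≡ sum (λ j → count (fibre D f (enum j)))
  count-fibres D f = begin
    count D
      ≡⟨ count≡sum D ⟩
    sum (λ i → iverson (D (enum i)))
      ≡⟨ sum-cong-≗ (λ i → countFin-graph (D (enum i)) (f (enum i))) ⟨
    sum (λ i → sum (λ j → iverson (fibre D f (enum j) (enum i))))
                                                    ≡⟨ ∑-comm (λ i j → iverson (fibre D f (enum j) (enum i))) ⟩
    sum (λ j → sum (λ i → iverson (fibre D f (enum j) (enum i))))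
                                                    ≡⟨ sum-cong-≗ (λ j → count≡sum (fibre D f (enum j))) ⟨
    sum (λ j → count (fibre D f (enum j))) ∎
    where
    open ≡.≡-Reasoning
    countFin-graph : ∀ b z → sum (λ j → iverson (b ∧ (z ≈ᵇ enum j))) ≡ iverson b
    countFin-graph b z = ≡.trans (≡.sym (countFin≡sum (λ j → b ∧ (z ≈ᵇ enum j)))) (by-cases b)
      where
      by-cases : ∀ b → countFin (λ j → b ∧ (z ≈ᵇ enum j)) ≡ iverson b
      by-cases false = countFin-none {size} (λ _ → false) (λ _ ())
      by-cases true  = countFin-unique (λ j → z ≈ᵇ enum j) (index z) (≈⇒≈ᵇ (≈-sym (enum-index z)))
        (λ j z≈j → enum-inj j (index z) (≈-trans (≈-sym (≈ᵇ⇒≈ z≈j)) (≈-sym (enum-index z))))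

  record IsBijection (D E : Pred) (f : Carrier → Carrier) : Set where
    field
      D-resp : Respects≈ D
      E-resp : Respects≈ E
      f-cong : Congruent f
      f-inj  : ∀ {x x′} → T (D x) → T (D x′) → f x ≈ f x′ → x ≈ x′
      f-into : ∀ {x} → T (D x) → T (E (f x))
      f-onto : ∀ {y} → T (E y) → ∃ λ x → T (D x) × f x ≈ y

  count-bijection : ∀ {D E f} → IsBijection D E f → count D ≡ count E
  count-bijection {D} {E} {f} bij = begin
    count D                                  ≡⟨ count-fibres D f ⟩
    sum (λ j → count (fibre D f (enum j)))   ≡⟨ sum-cong-≗ (λ j → count-fibre (enum j)) ⟩
    sum (iverson ∘ E ∘ enum)                 ≡⟨ count≡sum E ⟨
    count E                                  ∎
    where
    open ≡.≡-Reasoning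
    open IsBijection bij
    count-fibre : ∀ y → count (fibre D f y) ≡ iverson (E y)
    count-fibre y with E y in Ey
    ... | true  with f-onto (≡.subst T (≡.sym Ey) _)
    ...   | x , Dx , fx≈y = count-unique (fibre-resp D-resp f-cong y) (from T-∧ (Dx , ≈⇒≈ᵇ fx≈y))
            (λ x′ Dx′∧fx′≈y → let (Dx′ , fx′≈y) = to T-∧ Dx′∧fx′≈y in
              f-inj Dx′ Dx (≈-trans (≈ᵇ⇒≈ fx′≈y) (≈-sym fx≈y)))
    count-fibre y | false = count-none {fibre D f y} (λ x Dx∧fx≈y → let (Dx , fx≈y) = to T-∧ Dx∧fx≈y in
      ≡.subst T Ey (E-resp (≈ᵇ⇒≈ fx≈y) (f-into Dx)))

  record IsAdditiveSurjection (D E : Pred) (f : Carrier → Carrier) : Set where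
    field
      D-resp : Respects≈ D
      E-resp : Respects≈ E
      f-cong : Congruent f
      D-+    : ∀ {x y} → T (D x) → T (D y) → T (D (x + y))
      D-neg  : ∀ {x} → T (D x) → T (D (- x))
      f-+    : ∀ {x y} → T (D x) → T (D y) → f (x + y) ≈ f x + f y
      f-neg  : ∀ {x} → T (D x) → f (- x) ≈ - f x
      f-into : ∀ {x} → T (D x) → T (E (f x))
      f-onto : ∀ {y} → T (E y) → ∃ λ x → T (D x) × f x ≈ y

    kernel : Pred
    kernel = fibre D f 0#

    kernel-resp : Respects≈ kernel
    kernel-resp = fibre-resp D-resp f-cong 0#

  module _ {D E f} (hom : IsAdditiveSurjection D E f) where
    open IsAdditiveSurjection hom

    fibre-translation : ∀ {x₀ y} → T (D x₀) → f x₀ ≈ y → IsBijection (fibre D f y) kernel (λ x → x - x₀)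
    fibre-translation {x₀} {y} Dx₀ fx₀≈y = record
      { D-resp = fibre-resp D-resp f-cong y
      ; E-resp = fibre-resp D-resp f-cong 0#
      ; f-cong = +-congʳ
      ; f-inj  = λ {x} {x′} _ _ x-x₀≈x′-x₀ → begin
          x                 ≈⟨ solve 2 (λ x x₀ → x := (x :- x₀) :+ x₀) ≈-refl x x₀ ⟩
          (x - x₀) + x₀     ≈⟨ +-congʳ x-x₀≈x′-x₀ ⟩
          (x′ - x₀) + x₀    ≈⟨ solve 2 (λ x x₀ → (x :- x₀) :+ x₀ := x) ≈-refl x′ x₀ ⟩
          x′                ∎
      ; f-into = λ {x} Dx∧fx≈y → let (Dx , fx≈y) = to T-∧ Dx∧fx≈y in
          from T-∧ (D-+ Dx (D-neg Dx₀) , ≈⇒≈ᵇ (begin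
            f (x - x₀)      ≈⟨ f-+ Dx (D-neg Dx₀) ⟩
            f x + f (- x₀)  ≈⟨ +-congˡ (f-neg Dx₀) ⟩
            f x - f x₀      ≈⟨ +-cong (≈ᵇ⇒≈ fx≈y) (-‿cong fx₀≈y) ⟩
            y - y           ≈⟨ -‿inverseʳ y ⟩
            0#              ∎))
      ; f-onto = λ {z} Dz∧fz≈0 → let (Dz , fz≈0) = to T-∧ Dz∧fz≈0 in
          z + x₀ ,
          from T-∧ (D-+ Dz Dx₀ , ≈⇒≈ᵇ (begin
            f (z + x₀)      ≈⟨ f-+ Dz Dx₀ ⟩
            f z + f x₀      ≈⟨ +-cong (≈ᵇ⇒≈ fz≈0) fx₀≈y ⟩
            0# + y          ≈⟨ +-identityˡ y ⟩
            y               ∎)) ,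
          solve 2 (λ z x₀ → (z :+ x₀) :- x₀ := z) ≈-refl z x₀
      }
      where open ≈-Reasoning

    count-kernel-image : count D ≡ count kernel ℕ.* count E
    count-kernel-image = begin
      count D
        ≡⟨ count-fibres D f ⟩
      sum (λ j → count (fibre D f (enum j)))
        ≡⟨ sum-cong-≗ (λ j → count-fibre (enum j)) ⟩
      sum (λ j → count kernel ℕ.* iverson (E (enum j)))
                                                ≡⟨ *-distribˡ-sum (count kernel) (iverson ∘ E ∘ enum) ⟨
      count kernel ℕ.* sum (iverson ∘ E ∘ enum) ≡⟨ cong (count kernel ℕ.*_) (count≡sum E) ⟨
      count kernel ℕ.* count E                  ∎
      where
      open ≡.≡-Reasoning
      count-fibre : ∀ y → count (fibre D f y) ≡ count kernel ℕ.* iverson (E y)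
      count-fibre y with E y in Ey
      ... | true with f-onto (≡.subst T (≡.sym Ey) _)
      ...   | x₀ , Dx₀ , fx₀≈y =
        ≡.trans (count-bijection (fibre-translation Dx₀ fx₀≈y)) (≡.sym (ℕP.*-identityʳ _))
      count-fibre y | false = ≡.trans
        (count-none {fibre D f y} (λ x Dx∧fx≈y → let (Dx , fx≈y) = to T-∧ Dx∧fx≈y in
          ≡.subst T Ey (E-resp (≈ᵇ⇒≈ fx≈y) (f-into Dx))))
        (≡.sym (ℕP.*-zeroʳ (count kernel)))

  -- Characteristic, Frobenius and Fermat

  module +-Sum = CommutativeMonoidSum +-commutativeMonoid
  module *-Product = CommutativeMonoidSum *-commutativeMonoid

  module EnumPermutation (g h : Carrier → Carrier) (g-cong : Congruent g) (h-cong : Congruent h)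
                         (g∘h≈id : ∀ x → g (h x) ≈ x) (h∘g≈id : ∀ x → h (g x) ≈ x) where
    π : Permutation size size
    π = permutation (index ∘ g ∘ enum) (index ∘ h ∘ enum)
      (λ i → enum-inj _ _ (≈-trans (enum-index _) (≈-trans (g-cong (enum-index _)) (g∘h≈id _))))
      (λ i → enum-inj _ _ (≈-trans (enum-index _) (≈-trans (h-cong (enum-index _)) (h∘g≈id _))))

    enum-π : ∀ i → enum (π ⟨$⟩ʳ i) ≈ g (enum i)
    enum-π i = enum-index _

  ⟨size⟩≈0 : ⟨ size ⟩ ≈ 0#
  ⟨size⟩≈0 = begin
    ⟨ size ⟩
      ≈⟨ solve 2 (λ n s → n := (s :+ n) :- s) ≈-refl ⟨ size ⟩ Σ ⟩
    (Σ + ⟨ size ⟩) - Σ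
      ≈⟨ +-congʳ (+-congˡ (+-Sum.sum-replicate size)) ⟨
    (Σ + +-Sum.sum {size} (λ _ → 1#)) - Σ
                              ≈⟨ +-congʳ (+-Sum.∑-distrib-+ enum (λ _ → 1#)) ⟨
    +-Sum.sum (λ i → enum i + 1#) - Σ
                              ≈⟨ +-congʳ (+-Sum.sum-cong-≋ enum-π) ⟨
    +-Sum.sum (λ i → enum (π ⟨$⟩ʳ i)) - Σ
                              ≈⟨ +-congʳ (+-Sum.sum-permute enum π) ⟨
    Σ - Σ
      ≈⟨ -‿inverseʳ Σ ⟩
    0# ∎
    where
    open ≈-Reasoning
    Σ = +-Sum.sum enum
    open EnumPermutation (_+ 1#) (_- 1#) +-congʳ +-congʳ
      (λ x → solve 2 (λ x o → (x :- o) :+ o := x) ≈-refl x 1#)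
      (λ x → solve 2 (λ x o → (x :+ o) :- o := x) ≈-refl x 1#)

  ⟨⟩-homo-^ : ∀ m r → ⟨ m ℕ.^ r ⟩ ≈ ⟨ m ⟩ ^ r
  ⟨⟩-homo-^ m zero    = +-identityʳ 1#
  ⟨⟩-homo-^ m (suc r) = ≈-trans (×1-homo-* m (m ℕ.^ r)) (*-congˡ (⟨⟩-homo-^ m r))

  characteristic : ∀ {p r} → size ≡ p ℕ.^ r → ⟨ p ⟩ ≈ 0#
  characteristic {p} {r} size≡pʳ = x^n≈0⇒x≈0 r (begin
    ⟨ p ⟩ ^ r       ≈⟨ ⟨⟩-homo-^ p r ⟨
    ⟨ p ℕ.^ r ⟩     ≡⟨ cong ⟨_⟩ size≡pʳ ⟨
    ⟨ size ⟩        ≈⟨ ⟨size⟩≈0 ⟩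
    0#              ∎)
    where open ≈-Reasoning

  record Additive (m : ℕ) : Set where
    constructor mkAdditive
    field ^-distrib-+ : ∀ x y → (x + y) ^ m ≈ x ^ m + y ^ m
  open Additive public

  additive-* : ∀ {a b} → Additive a → Additive b → Additive (a ℕ.* b)
  additive-* {a} {b} additive-a additive-b = mkAdditive λ x y → begin
    (x + y) ^ (a ℕ.* b)           ≈⟨ ^-assocʳ (x + y) a b ⟨
    ((x + y) ^ a) ^ b             ≈⟨ ^-congˡ b (^-distrib-+ additive-a x y) ⟩
    (x ^ a + y ^ a) ^ b           ≈⟨ ^-distrib-+ additive-b (x ^ a) (y ^ a) ⟩
    (x ^ a) ^ b + (y ^ a) ^ b     ≈⟨ +-cong (^-assocʳ x a b) (^-assocʳ y a b) ⟩
    x ^ (a ℕ.* b) + y ^ (a ℕ.* b) ∎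
    where open ≈-Reasoning

  additive-^ : ∀ {a} → Additive a → ∀ k → Additive (a ℕ.^ k)
  additive-^ additive-a zero    = mkAdditive λ x y → solve 3 (λ x y o → (x :+ y) :* o := x :* o :+ y :* o) ≈-refl x y 1#
  additive-^ additive-a (suc k) = additive-* additive-a (additive-^ additive-a k)

  additive-neg : ∀ {m} → Additive m → 1 ≤ m → ∀ x → (- x) ^ m ≈ - (x ^ m)
  additive-neg {suc m} additive-m _ x = begin
    (- x) ^ suc m                               ≈⟨ solve 2 (λ y z → z := (y :+ z) :- y) ≈-refl (x ^ suc m) _ ⟩
    (x ^ suc m + (- x) ^ suc m) - x ^ suc m     ≈⟨ +-congʳ (^-distrib-+ additive-m x (- x)) ⟨
    (x - x) ^ suc m - x ^ suc m                 ≈⟨ +-congʳ (^-congˡ (suc m) (-‿inverseʳ x)) ⟩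
    0# ^ suc m - x ^ suc m                      ≈⟨ +-congʳ (zeroˡ _) ⟩
    0# - x ^ suc m                              ≈⟨ +-identityˡ _ ⟩
    - (x ^ suc m)                               ∎
    where open ≈-Reasoning

  additive-prime : ∀ {p} → Prime p → ⟨ p ⟩ ≈ 0# → Additive p
  additive-prime {p@(suc n)} p-prime p≈0 = mkAdditive λ x y → begin
    (x + y) ^ p                                         ≈⟨ ^≈^ (x + y) p ⟩
    (x + y) Exp.^ p                                     ≈⟨ Binomial.theorem commutativeSemiring p x y ⟩
    term x y zero + +-Sum.sum (λ i → term x y (suc i))  ≈⟨ +-congˡ (sum-last (term x y ∘ suc) (middle-term≈0 x y)) ⟩
    term x y zero + term x y (fromℕ p)                  ≈⟨ +-cong (first-term x y) (last-term x y) ⟩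
    y ^ p + x ^ p                                       ≈⟨ +-comm _ _ ⟩
    x ^ p + y ^ p                                       ∎
    where
    open ≈-Reasoning
    open MonoidMult +-monoid using (×-congʳ; ×-assocˡ; ×-homo-0) renaming (_×_ to _×ᴿ_)
    open SemiringMult semiring using (×-assoc-*)
    term : Carrier → Carrier → Fin (suc p) → Carrier
    term x y = Binomial.binomialTerm commutativeSemiring x y p

    sum-last : ∀ {k} (g : Fin (suc k) → Carrier) → (∀ i → toℕ i ℕ.< k → g i ≈ 0#) → +-Sum.sum g ≈ g (fromℕ k)
    sum-last {zero}  g _      = +-identityʳ _
    sum-last {suc k} g g≈0 = ≈-trans (+-cong (g≈0 zero (s≤s z≤n)) (sum-last (g ∘ suc) (λ i i<k → g≈0 (suc i) (s≤s i<k))))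
                                      (+-identityˡ _)

    first-term : ∀ x y → term x y zero ≈ y ^ p
    first-term x y = ≈-trans (+-identityʳ _) (≈-trans (*-identityˡ _) (≈-sym (^≈^ y p)))

    last-term : ∀ x y → term x y (fromℕ p) ≈ x ^ p
    last-term x y = begin
      term x y (fromℕ p)                         ≡⟨ cong F (FinP.toℕ-fromℕ p) ⟩
      F p                                        ≡⟨ cong₂ (λ c e → c ×ᴿ (x Exp.^ p * y Exp.^ e)) (nCn≡1 p) (ℕP.n∸n≡0 p) ⟩
      1 ×ᴿ (x Exp.^ p * 1#)                      ≈⟨ ≈-trans (+-identityʳ _) (*-identityʳ _) ⟩
      x Exp.^ p                                  ≈⟨ ^≈^ x p ⟨
      x ^ p                                      ∎
      where
      F : ℕ → Carrier
      F k = (p C k) ×ᴿ (x Exp.^ k * y Exp.^ (p ℕ.∸ k))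

    middle-term≈0 : ∀ x y i → toℕ i ℕ.< n → term x y (suc i) ≈ 0#
    middle-term≈0 x y i i<n with prime∣pCk p-prime (s≤s z≤n) (s≤s i<n)
    ... | divides d pCk≡d*p = begin
      (p C suc (toℕ i)) ×ᴿ b    ≡⟨ cong (_×ᴿ b) pCk≡d*p ⟩
      (d ℕ.* p) ×ᴿ b            ≈⟨ ×-assocˡ b d p ⟨
      d ×ᴿ (p ×ᴿ b)             ≈⟨ ×-congʳ d p×b≈0 ⟩
      d ×ᴿ 0#                   ≈⟨ d×0≈0 d ⟩
      0#                        ∎
      where
      b = Binomial.binomial commutativeSemiring x y p (suc i)
      p×b≈0 : p ×ᴿ b ≈ 0#
      p×b≈0 = begin
        p ×ᴿ b          ≈⟨ ×-congʳ p (*-identityˡ b) ⟨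
        p ×ᴿ (1# * b)   ≈⟨ ×-assoc-* p 1# b ⟨
        ⟨ p ⟩ * b       ≈⟨ *-congʳ p≈0 ⟩
        0# * b          ≈⟨ zeroˡ b ⟩
        0#              ∎
      d×0≈0 : ∀ d → d ×ᴿ 0# ≈ 0#
      d×0≈0 zero    = ≈-refl
      d×0≈0 (suc d) = ≈-trans (+-identityˡ _) (d×0≈0 d)

  nonzero-part : Carrier → Carrier
  nonzero-part x = if x ≈ᵇ 0# then 1# else x

  nonzero-part≉0 : ∀ x → ¬ nonzero-part x ≈ 0#
  nonzero-part≉0 x with x ≟ 0#
  ... | yes _   = λ 1≈0 → 0≉1 (≈-sym 1≈0)
  ... | no x≉0 = x≉0

  nonzero-part-cong : Congruent nonzero-part
  nonzero-part-cong {x} {y} x≈y with x ≟ 0# | y ≟ 0#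
  ... | yes _   | yes _   = ≈-refl
  ... | yes x≈0 | no y≉0 = ⊥-elim (y≉0 (≈-trans (≈-sym x≈y) x≈0))
  ... | no x≉0 | yes y≈0 = ⊥-elim (x≉0 (≈-trans x≈y y≈0))
  ... | no _    | no _    = x≈y

  product≉0 : ∀ {m} (f : Fin m → Carrier) → (∀ i → ¬ f i ≈ 0#) → ¬ *-Product.sum f ≈ 0#
  product≉0 {zero}  f _     1≈0 = 0≉1 (≈-sym 1≈0)
  product≉0 {suc m} f f≉0 = x≉0∧y≉0⇒x*y≉0 (f≉0 zero) (product≉0 (f ∘ suc) (f≉0 ∘ suc))

  product-if : ∀ a {m} (b : Fin m → Bool) → *-Product.sum (λ i → if b i then 1# else a) ≈ a ^ countFin (not ∘ b)
  product-if a {zero}  b = ≈-refl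
  product-if a {suc m} b with b zero
  ... | true  = ≈-trans (*-identityˡ _) (product-if a (b ∘ suc))
  ... | false = *-congˡ (product-if a (b ∘ suc))

  #nonzero : ℕ
  #nonzero = count (not ∘ (_≈ᵇ 0#))

  size≡1+#nonzero : size ≡ suc #nonzero
  size≡1+#nonzero = begin
    size                           ≡⟨ countFin-not ((_≈ᵇ 0#) ∘ enum) ⟨
    #nonzero ℕ.+ count (_≈ᵇ 0#)    ≡⟨ cong (#nonzero ℕ.+_) (count-≈ᵇ 0#) ⟩
    #nonzero ℕ.+ 1                 ≡⟨ ℕP.+-comm #nonzero 1 ⟩
    suc #nonzero                   ∎
    where open ≡.≡-Reasoning

  a^#nonzero≈1 : ∀ {a} → ¬ a ≈ 0# → a ^ #nonzero ≈ 1#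
  a^#nonzero≈1 {a} a≉0 = *-cancelʳ (product≉0 _ (nonzero-part≉0 ∘ enum)) (begin
    a ^ #nonzero * Π
      ≈⟨ *-congʳ (product-if a ((_≈ᵇ 0#) ∘ enum)) ⟨
    *-Product.sum (λ i → scale (enum i)) * Π
      ≈⟨ *-Product.∑-distrib-+ (scale ∘ enum) (nonzero-part ∘ enum) ⟨
    *-Product.sum (λ i → scale (enum i) * nonzero-part (enum i))
                                                            ≈⟨ *-Product.sum-cong-≋ (λ i → nonzero-part-* (enum i)) ⟨
    *-Product.sum (λ i → nonzero-part (a * enum i))
      ≈⟨ *-Product.sum-cong-≋ (λ i → nonzero-part-cong (enum-π i)) ⟨
    *-Product.sum (λ i → nonzero-part (enum (π ⟨$⟩ʳ i)))
      ≈⟨ *-Product.sum-permute (nonzero-part ∘ enum) π ⟨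
    Π
      ≈⟨ *-identityˡ Π ⟨
    1# * Π ∎)
    where
    open ≈-Reasoning
    Π = *-Product.sum (nonzero-part ∘ enum)
    scale : Carrier → Carrier
    scale y = if y ≈ᵇ 0# then 1# else a
    nonzero-part-* : ∀ y → nonzero-part (a * y) ≈ scale y * nonzero-part y
    nonzero-part-* y with y ≟ 0# | (a * y) ≟ 0#
    ... | yes _   | yes _    = ≈-sym (*-identityˡ _)
    ... | yes y≈0 | no ay≉0 = ⊥-elim (ay≉0 (≈-trans (*-congˡ y≈0) (zeroʳ a)))
    ... | no y≉0  | yes ay≈0 = ⊥-elim (x≉0∧y≉0⇒x*y≉0 a≉0 y≉0 ay≈0)
    ... | no _    | no _     = ≈-refl
    open EnumPermutation (a *_) (a ⁻¹ *_) *-congˡ *-congˡ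
      (λ x → ≈-trans (≈-sym (*-assoc _ _ _)) (≈-trans (*-congʳ (x*x⁻¹≈1 a≉0)) (*-identityˡ x)))
      (λ x → ≈-trans (≈-sym (*-assoc _ _ _)) (≈-trans (*-congʳ (x⁻¹*x≈1 a≉0)) (*-identityˡ x)))

  fermat : ∀ x → x ^ size ≈ x
  fermat x rewrite size≡1+#nonzero with x ≟ 0#
  ... | yes x≈0 = ≈-trans (*-congʳ x≈0) (≈-trans (zeroˡ _) (≈-sym x≈0))
  ... | no x≉0  = ≈-trans (*-congˡ (a^#nonzero≈1 x≉0)) (*-identityʳ x)

  -- Roots of polynomial functions

  evalMonic : ∀ {d} → Vec Carrier d → Carrier → Carrier
  evalMonic []       x = 1#
  evalMonic (c ∷ cs) x = c + x * evalMonic cs x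

  eval : ∀ {d} → Vec Carrier d → Carrier → Carrier
  eval []       x = 0#
  eval (c ∷ cs) x = c + x * eval cs x

  Monic : ℕ → (Carrier → Carrier) → Set
  Monic d f = ∃ λ (cs : Vec Carrier d) → ∀ x → f x ≈ evalMonic cs x

  DegreeBelow : ℕ → (Carrier → Carrier) → Set
  DegreeBelow d f = ∃ λ (cs : Vec Carrier d) → ∀ x → f x ≈ eval cs x

  quotient : ∀ {d} → Vec Carrier (suc d) → Carrier → Vec Carrier d
  quotient (c ∷ [])          a = []
  quotient (c ∷ cs@(_ ∷ _)) a = evalMonic cs a ∷ quotient cs a

  evalMonic-division : ∀ {d} (cs : Vec Carrier (suc d)) a x →
                       evalMonic cs x ≈ (x - a) * evalMonic (quotient cs a) x + evalMonic cs a
  evalMonic-division (c ∷ []) a x =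
    solve 4 (λ c a x o → c :+ x :* o := (x :- a) :* o :+ (c :+ a :* o)) ≈-refl c a x 1#
  evalMonic-division (c ∷ cs@(_ ∷ _)) a x = begin
    c + x * evalMonic cs x              ≈⟨ +-congˡ (*-congˡ (evalMonic-division cs a x)) ⟩
    c + x * ((x - a) * q + r)           ≈⟨ solve 5 (λ c x a q r → c :+ x :* ((x :- a) :* q :+ r) :=
                                                     (x :- a) :* (r :+ x :* q) :+ (c :+ a :* r)) ≈-refl c x a q r ⟩
    (x - a) * (r + x * q) + (c + a * r) ∎
    where
    open ≈-Reasoning
    q = evalMonic (quotient cs a) x
    r = evalMonic cs a

  evalMonic-cong : ∀ {d} (cs : Vec Carrier d) → Congruent (evalMonic cs)
  evalMonic-cong []       x≈y = ≈-refl
  evalMonic-cong (c ∷ cs) x≈y = +-congˡ (*-cong x≈y (evalMonic-cong cs x≈y))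

  zeros : (Carrier → Carrier) → Pred
  zeros f x = f x ≈ᵇ 0#

  count-roots≤degree : ∀ {d} (cs : Vec Carrier d) → count (zeros (evalMonic cs)) ≤ d
  count-roots≤degree [] = ℕP.≤-reflexive (count-none (λ x 1≈0 → 0≉1 (≈-sym (≈ᵇ⇒≈ 1≈0))))
  count-roots≤degree {suc d} cs with anyFin (zeros (evalMonic cs) ∘ enum) in any-root
  ... | false = ℕP.≤-trans (ℕP.≤-reflexive (count-none no-root)) z≤n
    where
    no-root : ∀ x → ¬ T (evalMonic cs x ≈ᵇ 0#)
    no-root x x-root = ≡.subst T any-root (∃⇒anyFin _ (index x)
      (≈⇒≈ᵇ (≈-trans (evalMonic-cong cs (enum-index x)) (≈ᵇ⇒≈ x-root))))
  ... | true with anyFin⇒∃ _ (≡.subst T (≡.sym any-root) _)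
  ...   | i , a-root = begin
    count (zeros (evalMonic cs))
      ≤⟨ count-∪ root-split ⟩
    count (_≈ᵇ a) ℕ.+ count (zeros (evalMonic (quotient cs a)))
                                                             ≡⟨ cong (ℕ._+ count (zeros (evalMonic (quotient cs a)))) (count-≈ᵇ a) ⟩
    suc (count (zeros (evalMonic (quotient cs a))))
      ≤⟨ s≤s (count-roots≤degree (quotient cs a)) ⟩
    suc d ∎
    where
    open ℕP.≤-Reasoning
    a = enum i
    root-split : ∀ x → T (evalMonic cs x ≈ᵇ 0#) → T (x ≈ᵇ a) ⊎ T (evalMonic (quotient cs a) x ≈ᵇ 0#)
    root-split x x-root with x*y≈0⇒x≈0⊎y≈0 (≈-trans (≈-sym (≈-trans
        (evalMonic-division cs a x) (≈-trans (+-congˡ (≈ᵇ⇒≈ a-root)) (+-identityʳ _)))) (≈ᵇ⇒≈ x-root))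
    ... | inj₁ x-a≈0 = inj₁ (≈⇒≈ᵇ (x-y≈0⇒x≈y x-a≈0))
    ... | inj₂ q≈0   = inj₂ (≈⇒≈ᵇ q≈0)

  monic-roots≤degree : ∀ {d f} → Monic d f → count (zeros f) ≤ d
  monic-roots≤degree (cs , f≈cs) = ℕP.≤-trans
    (count-mono (λ x fx≈0 → ≈⇒≈ᵇ (≈-trans (≈-sym (f≈cs x)) (≈ᵇ⇒≈ fx≈0))))
    (count-roots≤degree cs)

  degreeBelow-0 : ∀ d → DegreeBelow d (λ _ → 0#)
  degreeBelow-0 zero    = [] , λ _ → ≈-refl
  degreeBelow-0 (suc d) with cs , 0≈cs ← degreeBelow-0 d =
    0# ∷ cs , λ x → ≈-sym (≈-trans (+-identityˡ _) (≈-trans (*-congˡ (≈-sym (0≈cs x))) (zeroʳ x)))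

  eval-+ : ∀ {d} (cs ds : Vec Carrier d) x → eval (zipWith _+_ cs ds) x ≈ eval cs x + eval ds x
  eval-+ []       []       x = ≈-sym (+-identityʳ 0#)
  eval-+ (c ∷ cs) (d ∷ ds) x = ≈-trans (+-congˡ (*-congˡ (eval-+ cs ds x)))
    (solve 5 (λ c d x u v → (c :+ d) :+ x :* (u :+ v) := (c :+ x :* u) :+ (d :+ x :* v)) ≈-refl c d x (eval cs x) (eval ds x))

  degreeBelow-+ : ∀ {d f g} → DegreeBelow d f → DegreeBelow d g → DegreeBelow d (λ x → f x + g x)
  degreeBelow-+ (cs , f≈cs) (ds , g≈ds) = zipWith _+_ cs ds , λ x → ≈-trans (+-cong (f≈cs x) (g≈ds x)) (≈-sym (eval-+ cs ds x))

  eval-neg : ∀ {d} (cs : Vec Carrier d) x → eval (map -_ cs) x ≈ - eval cs x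
  eval-neg []       x = ≈-sym -0#≈0#
  eval-neg (c ∷ cs) x = ≈-trans (+-congˡ (*-congˡ (eval-neg cs x)))
    (solve 3 (λ c x u → :- c :+ x :* (:- u) := :- (c :+ x :* u)) ≈-refl c x (eval cs x))

  degreeBelow-neg : ∀ {d f} → DegreeBelow d f → DegreeBelow d (λ x → - f x)
  degreeBelow-neg (cs , f≈cs) = map -_ cs , λ x → ≈-trans (-‿cong (f≈cs x)) (≈-sym (eval-neg cs x))

  degreeBelow-suc : ∀ {d f} → DegreeBelow d f → DegreeBelow (suc d) f
  degreeBelow-suc (cs , f≈cs) = pad cs , λ x → ≈-trans (f≈cs x) (≈-sym (eval-pad cs x))
    where
    pad : ∀ {d} → Vec Carrier d → Vec Carrier (suc d)
    pad []       = 0# ∷ []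
    pad (c ∷ cs) = c ∷ pad cs
    eval-pad : ∀ {d} (cs : Vec Carrier d) x → eval (pad cs) x ≈ eval cs x
    eval-pad []       x = ≈-trans (+-congˡ (zeroʳ x)) (+-identityʳ 0#)
    eval-pad (c ∷ cs) x = +-congˡ (*-congˡ (eval-pad cs x))

  degreeBelow-mono : ∀ {d d′ f} → d ≤ d′ → DegreeBelow d f → DegreeBelow d′ f
  degreeBelow-mono d≤d′ = go (ℕP.≤⇒≤′ d≤d′)
    where
    go : ∀ {d d′ f} → d ℕ.≤′ d′ → DegreeBelow d f → DegreeBelow d′ f
    go ℕ.≤′-refl        = λ f-poly → f-poly
    go (ℕ.≤′-step d≤′d′) = degreeBelow-suc ∘ go d≤′d′

  degreeBelow-^ : ∀ {j d} → j < d → DegreeBelow d (_^ j)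
  degreeBelow-^ {j} j<d = degreeBelow-mono j<d (power j)
    where
    power : ∀ j → DegreeBelow (suc j) (_^ j)
    power zero    = 1# ∷ [] , λ x → ≈-sym (≈-trans (+-congˡ (zeroʳ x)) (+-identityʳ 1#))
    power (suc j) with cs , xʲ≈cs ← power j =
      0# ∷ cs , λ x → ≈-sym (≈-trans (+-identityˡ _) (*-congˡ (≈-sym (xʲ≈cs x))))

  monic-^ : ∀ d → Monic d (_^ d)
  monic-^ zero    = [] , λ _ → ≈-refl
  monic-^ (suc d) with cs , xᵈ≈cs ← monic-^ d =
    0# ∷ cs , λ x → ≈-sym (≈-trans (+-identityˡ _) (*-congˡ (≈-sym (xᵈ≈cs x))))

  evalMonic-+ : ∀ {d} (cs ds : Vec Carrier d) x → evalMonic (zipWith _+_ cs ds) x ≈ evalMonic cs x + eval ds x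
  evalMonic-+ []       []       x = ≈-sym (+-identityʳ 1#)
  evalMonic-+ (c ∷ cs) (d ∷ ds) x = ≈-trans (+-congˡ (*-congˡ (evalMonic-+ cs ds x)))
    (solve 5 (λ c d x u v → (c :+ d) :+ x :* (u :+ v) := (c :+ x :* u) :+ (d :+ x :* v)) ≈-refl c d x (evalMonic cs x) (eval ds x))

  monic-+ : ∀ {d f g} → Monic d f → DegreeBelow d g → Monic d (λ x → f x + g x)
  monic-+ (cs , f≈cs) (ds , g≈ds) = zipWith _+_ cs ds , λ x → ≈-trans (+-cong (f≈cs x) (g≈ds x)) (≈-sym (evalMonic-+ cs ds x))

  monic-cong : ∀ {d f g} → (∀ x → g x ≈ f x) → Monic d f → Monic d g
  monic-cong g≈f (cs , f≈cs) = cs , λ x → ≈-trans (g≈f x) (f≈cs x)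

  -- Fixed fields of additive powers, and traces onto them

  module FixedField {a} (additive-a : Additive a) (1≤a : 1 ≤ a) where
    Fixed : Carrier → Set
    Fixed x = x ^ a ≈ x

    fixed? : Pred
    fixed? x = x ^ a ≈ᵇ x

    fixed-resp : ∀ {x y} → x ≈ y → Fixed x → Fixed y
    fixed-resp x≈y xᵃ≈x = ≈-trans (^-congˡ a (≈-sym x≈y)) (≈-trans xᵃ≈x x≈y)

    fixed?-resp : Respects≈ fixed?
    fixed?-resp x≈y x-fixed = ≈⇒≈ᵇ (fixed-resp x≈y (≈ᵇ⇒≈ x-fixed))

    fixed-0 : Fixed 0#
    fixed-0 = 0^n≈0 1≤a

    fixed-+ : ∀ {x y} → Fixed x → Fixed y → Fixed (x + y)
    fixed-+ x-fixed y-fixed = ≈-trans (^-distrib-+ additive-a _ _) (+-cong x-fixed y-fixed)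

    fixed-neg : ∀ {x} → Fixed x → Fixed (- x)
    fixed-neg x-fixed = ≈-trans (additive-neg additive-a 1≤a _) (-‿cong x-fixed)

    fixed-- : ∀ {x y} → Fixed x → Fixed y → Fixed (x - y)
    fixed-- x-fixed y-fixed = fixed-+ x-fixed (fixed-neg y-fixed)

    fixed-* : ∀ {x y} → Fixed x → Fixed y → Fixed (x * y)
    fixed-* x-fixed y-fixed = ≈-trans (^-distrib-* _ _ a) (*-cong x-fixed y-fixed)

    fixed-⁻¹ : ∀ {x} → Fixed x → Fixed (x ⁻¹)
    fixed-⁻¹ {x} x-fixed = ≈-trans (⁻¹-^ x a) (⁻¹-cong x-fixed)

    fixed-^ : ∀ {x} → Fixed x → ∀ j → x ^ (a ℕ.^ j) ≈ x
    fixed-^ x-fixed zero    = x^1≈x _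
    fixed-^ {x} x-fixed (suc j) = begin
      x ^ (a ℕ.* a ℕ.^ j)    ≈⟨ ^-assocʳ x a (a ℕ.^ j) ⟨
      (x ^ a) ^ (a ℕ.^ j)    ≈⟨ ^-congˡ (a ℕ.^ j) x-fixed ⟩
      x ^ (a ℕ.^ j)          ≈⟨ fixed-^ x-fixed j ⟩
      x                      ∎
      where open ≈-Reasoning

    proportional : ∀ {s τ s₀ τ₀} → Fixed s → Fixed τ → Fixed s₀ → Fixed τ₀ → ¬ (s₀ ≈ 0# × τ₀ ≈ 0#) →
                   s * τ₀ ≈ τ * s₀ → ∃ λ c → Fixed c × s ≈ c * s₀ × τ ≈ c * τ₀
    proportional {s} {τ} {s₀} {τ₀} s∈ τ∈ s₀∈ τ₀∈ v₀≉0 det≈0 with s₀ ≟ 0# | τ₀ ≟ 0#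
    ... | no s₀≉0  | _         = let (s≈ , τ≈) = parallel⇒multiple s₀≉0 det≈0 in
      s * s₀ ⁻¹ , fixed-* s∈ (fixed-⁻¹ s₀∈) , s≈ , τ≈
    ... | yes _     | no τ₀≉0  = let (τ≈ , s≈) = parallel⇒multiple τ₀≉0 (≈-sym det≈0) in
      τ * τ₀ ⁻¹ , fixed-* τ∈ (fixed-⁻¹ τ₀∈) , s≈ , τ≈
    ... | yes s₀≈0 | yes τ₀≈0 = ⊥-elim (v₀≉0 (s₀≈0 , τ₀≈0))

    additive-aʲ : ∀ j → Additive (a ℕ.^ j)
    additive-aʲ = additive-^ additive-a

    1≤aʲ : ∀ j → 1 ≤ a ℕ.^ j
    1≤aʲ j = ℕP.m^n>0 a {{ℕ.>-nonZero 1≤a}} j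

    Tr-cong : ∀ j → Congruent (Tr K a j)
    Tr-cong zero    x≈y = ≈-refl
    Tr-cong (suc j) x≈y = +-cong (Tr-cong j x≈y) (^-congˡ (a ℕ.^ j) x≈y)

    Tr-+ : ∀ j x y → Tr K a j (x + y) ≈ Tr K a j x + Tr K a j y
    Tr-+ zero    x y = ≈-sym (+-identityʳ 0#)
    Tr-+ (suc j) x y = ≈-trans (+-cong (Tr-+ j x y) (^-distrib-+ (additive-aʲ j) x y))
      (solve 4 (λ s t u v → (s :+ t) :+ (u :+ v) := (s :+ u) :+ (t :+ v)) ≈-refl _ _ _ _)

    Tr-neg : ∀ j x → Tr K a j (- x) ≈ - Tr K a j x
    Tr-neg zero    x = ≈-sym -0#≈0#
    Tr-neg (suc j) x = ≈-trans (+-cong (Tr-neg j x) (additive-neg (additive-aʲ j) (1≤aʲ j) x)) (-‿+-comm _ _)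

    Tr-- : ∀ j x y → Tr K a j (x - y) ≈ Tr K a j x - Tr K a j y
    Tr-- j x y = ≈-trans (Tr-+ j x (- y)) (+-congˡ (Tr-neg j y))

    Tr-scale : ∀ j {c} → Fixed c → ∀ x → Tr K a j (c * x) ≈ c * Tr K a j x
    Tr-scale zero    c-fixed x = ≈-sym (zeroʳ _)
    Tr-scale (suc j) {c} c-fixed x = begin
      Tr K a j (c * x) + (c * x) ^ (a ℕ.^ j)
        ≈⟨ +-cong (Tr-scale j c-fixed x) (^-distrib-* c x (a ℕ.^ j)) ⟩
      c * Tr K a j x + c ^ (a ℕ.^ j) * x ^ (a ℕ.^ j)
                                                ≈⟨ +-congˡ (*-congʳ (fixed-^ c-fixed j)) ⟩
      c * Tr K a j x + c * x ^ (a ℕ.^ j)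
        ≈⟨ distribˡ c _ _ ⟨
      c * (Tr K a j x + x ^ (a ℕ.^ j)) ∎
      where open ≈-Reasoning

    Tr-telescope : ∀ j x → Tr K a j (x ^ a - x) ≈ x ^ (a ℕ.^ j) - x
    Tr-telescope zero    x = ≈-sym (≈-trans (+-congʳ (x^1≈x x)) (-‿inverseʳ x))
    Tr-telescope (suc j) x = begin
      Tr K a j (x ^ a - x) + (x ^ a - x) ^ aʲ     ≈⟨ +-cong (Tr-telescope j x) (^-distrib-+ (additive-aʲ j) _ _) ⟩
      (x ^ aʲ - x) + ((x ^ a) ^ aʲ + (- x) ^ aʲ)  ≈⟨ +-congˡ (+-cong (^-assocʳ x a aʲ) (additive-neg (additive-aʲ j) (1≤aʲ j) x)) ⟩
      (x ^ aʲ - x) + (x ^ (a ℕ.* aʲ) - x ^ aʲ)    ≈⟨ solve 3 (λ u x v → (u :- x) :+ (v :- u) := v :- x) ≈-refl (x ^ aʲ) x _ ⟩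
      x ^ (a ℕ.* aʲ) - x                          ∎
      where
      open ≈-Reasoning
      aʲ = a ℕ.^ j

    Tr-shift : ∀ j u → Tr K a j (u ^ a) + u ≈ Tr K a j u + u ^ (a ℕ.^ j)
    Tr-shift zero    u = +-congˡ (≈-sym (x^1≈x u))
    Tr-shift (suc j) u = begin
      (Tr K a j (u ^ a) + (u ^ a) ^ aʲ) + u       ≈⟨ solve 3 (λ s t u → (s :+ t) :+ u := (s :+ u) :+ t) ≈-refl _ _ _ ⟩
      (Tr K a j (u ^ a) + u) + (u ^ a) ^ aʲ       ≈⟨ +-cong (Tr-shift j u) (^-assocʳ u a aʲ) ⟩
      (Tr K a j u + u ^ aʲ) + u ^ (a ℕ.* aʲ)      ∎
      where
      open ≈-Reasoning
      aʲ = a ℕ.^ j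

    Tr-^ : ∀ j u → (Tr K a j u) ^ a ≈ Tr K a j (u ^ a)
    Tr-^ zero    u = fixed-0
    Tr-^ (suc j) u = ≈-trans (^-distrib-+ additive-a _ _) (+-cong (Tr-^ j u) (^-comm u (a ℕ.^ j) a))
      where
      ^-comm : ∀ x m n → (x ^ m) ^ n ≈ (x ^ n) ^ m
      ^-comm x m n = ≈-trans (^-assocʳ x m n) (≈-trans (≡⇒≈ (cong (x ^_) (ℕP.*-comm m n))) (≈-sym (^-assocʳ x n m)))

    Tr-fixed : ∀ j {u} → u ^ (a ℕ.^ j) ≈ u → Fixed (Tr K a j u)
    Tr-fixed j {u} u-fixed = begin
      (Tr K a j u) ^ a                   ≈⟨ Tr-^ j u ⟩
      Tr K a j (u ^ a)                   ≈⟨ solve 2 (λ s u → s := (s :+ u) :- u) ≈-refl _ u ⟩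
      (Tr K a j (u ^ a) + u) - u         ≈⟨ +-congʳ (Tr-shift j u) ⟩
      (Tr K a j u + u ^ (a ℕ.^ j)) - u   ≈⟨ +-congʳ (+-congˡ u-fixed) ⟩
      (Tr K a j u + u) - u               ≈⟨ solve 2 (λ s u → (s :+ u) :- u := s) ≈-refl _ u ⟩
      Tr K a j u                         ∎
      where open ≈-Reasoning

    degreeBelow-Tr : ∀ j {d} → (∀ i → i < j → a ℕ.^ i < d) → DegreeBelow d (Tr K a j)
    degreeBelow-Tr zero    {d} _       = degreeBelow-0 d
    degreeBelow-Tr (suc j)     aⁱ<d = degreeBelow-+ (degreeBelow-Tr j (λ i i<j → aⁱ<d i (ℕP.m<n⇒m<1+n i<j)))
                                                    (degreeBelow-^ (aⁱ<d j (ℕP.n<1+n j)))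

    monic-Tr : 1 < a → ∀ j → Monic (a ℕ.^ j) (Tr K a (suc j))
    monic-Tr 1<a j = monic-cong (λ x → +-comm _ _)
      (monic-+ (monic-^ (a ℕ.^ j)) (degreeBelow-Tr j (λ i i<j → ℕP.^-monoʳ-< a 1<a i<j)))

    ℘ : Carrier → Carrier
    ℘ x = x ^ a - x

    ℘-cong : Congruent ℘
    ℘-cong x≈y = +-cong (^-congˡ a x≈y) (-‿cong x≈y)

    count-fixed≡count-zeros-℘ : count fixed? ≡ count (zeros ℘)
    count-fixed≡count-zeros-℘ = count-cong {fixed?} {zeros ℘}
      (λ x xᵃ≈x → ≈⇒≈ᵇ (x≈y⇒x∙y⁻¹≈ε (≈ᵇ⇒≈ xᵃ≈x)))
      (λ x ℘x≈0 → ≈⇒≈ᵇ (x-y≈0⇒x≈y (≈ᵇ⇒≈ ℘x≈0)))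

    ℘-image : Pred
    ℘-image y = anyFin (λ i → ℘ (enum i) ≈ᵇ y)

    ℘-image-resp : Respects≈ ℘-image
    ℘-image-resp {y} {y′} y≈y′ y∈image with i , ℘ᵢ≈y ← anyFin⇒∃ (λ i → ℘ (enum i) ≈ᵇ y) y∈image =
      ∃⇒anyFin _ i (≈⇒≈ᵇ (≈-trans (≈ᵇ⇒≈ ℘ᵢ≈y) y≈y′))

    ℘-surjection : IsAdditiveSurjection (λ _ → true) ℘-image ℘
    ℘-surjection = record
      { D-resp = λ _ _ → _
      ; E-resp = ℘-image-resp
      ; f-cong = ℘-cong
      ; D-+    = λ _ _ → _
      ; D-neg  = λ _ → _
      ; f-+    = λ {x} {y} _ _ → ≈-trans (+-congʳ (^-distrib-+ additive-a x y))
          (solve 4 (λ X Y x y → (X :+ Y) :- (x :+ y) := (X :- x) :+ (Y :- y)) ≈-refl (x ^ a) (y ^ a) x y)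
      ; f-neg  = λ {x} _ → ≈-trans (+-congʳ (additive-neg additive-a 1≤a x))
          (solve 2 (λ X x → :- X :- (:- x) := :- (X :- x)) ≈-refl (x ^ a) x)
      ; f-into = λ {x} _ → ∃⇒anyFin _ (index x) (≈⇒≈ᵇ (℘-cong (enum-index x)))
      ; f-onto = λ y∈image → let (i , ℘ᵢ≈y) = anyFin⇒∃ _ y∈image in enum i , _ , ≈ᵇ⇒≈ ℘ᵢ≈y
      }

    module _ {m} (1<a : 1 < a) (size≡a^[1+m] : size ≡ a ℕ.^ suc m) where

      monic-℘ : Monic a ℘
      monic-℘ = monic-cong {f = λ x → x ^ a - x ^ 1} {g = ℘} (λ x → +-congˡ (-‿cong (≈-sym (x^1≈x x))))
        (monic-+ (monic-^ a) (degreeBelow-neg (degreeBelow-^ 1<a)))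

      ℘-image⊆zeros-Tr : ∀ y → T (℘-image y) → T (zeros (Tr K a (suc m)) y)
      ℘-image⊆zeros-Tr y y∈image with i , ℘ᵢ≈y ← anyFin⇒∃ _ y∈image = ≈⇒≈ᵇ (begin
        Tr K a (suc m) y                  ≈⟨ Tr-cong (suc m) (≈ᵇ⇒≈ ℘ᵢ≈y) ⟨
        Tr K a (suc m) (℘ x)              ≈⟨ Tr-telescope (suc m) x ⟩
        x ^ (a ℕ.^ suc m) - x             ≡⟨ cong (λ n → x ^ n - x) size≡a^[1+m] ⟨
        x ^ size - x                      ≈⟨ x≈y⇒x∙y⁻¹≈ε (fermat x) ⟩
        0#                                ∎)
        where
        open ≈-Reasoning
        x = enum i

      count-℘-image≤ : count ℘-image ≤ a ℕ.^ m
      count-℘-image≤ = ℕP.≤-trans (count-mono ℘-image⊆zeros-Tr) (monic-roots≤degree (monic-Tr 1<a m))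

      count-fixed : count fixed? ≡ a
      count-fixed = ℕP.≤-antisym
        (ℕP.≤-trans (ℕP.≤-reflexive count-fixed≡count-zeros-℘) (monic-roots≤degree monic-℘))
        (ℕP.*-cancelʳ-≤ a (count fixed?) (a ℕ.^ m) {{ℕP.m^n≢0 a m {{ℕ.>-nonZero 1≤a}}}} (begin
          a ℕ.* a ℕ.^ m                        ≡⟨ size≡a^[1+m] ⟨
          size                                 ≡⟨ count-all ⟨
          count (λ _ → true)                   ≡⟨ count-kernel-image ℘-surjection ⟩
          count (zeros ℘) ℕ.* count ℘-image    ≡⟨ cong (ℕ._* count ℘-image) count-fixed≡count-zeros-℘ ⟨
          count fixed? ℕ.* count ℘-image       ≤⟨ ℕP.*-monoʳ-≤ (count fixed?) count-℘-image≤ ⟩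
          count fixed? ℕ.* a ℕ.^ m             ∎))
        where open ℕP.≤-Reasoning

-- The tower F_q ⊆ F_{q^t} ⊆ K

module QuadraticExtension (K : FiniteField) {p e q t : ℕ}
                          (p-prime : Prime p) (1≤e : 1 ≤ e) (q≡pᵉ : q ≡ p ℕ.^ e) (1≤t : 1 ≤ t)
                          (size≡q^[2t] : FiniteField.size K ≡ q ℕ.^ (2 ℕ.* t)) where
  open FiniteFieldTheory K

  1<q : 1 < q
  1<q = ≡.subst (1 <_) (≡.sym q≡pᵉ) (ℕP.^-monoʳ-< p (ℕ.nonTrivial⇒n>1 p {{prime⇒nonTrivial p-prime}}) 1≤e)

  1≤q : 1 ≤ q
  1≤q = ℕP.<⇒≤ 1<q

  additive-q : Additive q
  additive-q = ≡.subst Additive (≡.sym q≡pᵉ)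
    (additive-^ (additive-prime p-prime (characteristic {p} {e ℕ.* (2 ℕ.* t)} size≡p^[e*2t])) e)
    where
    size≡p^[e*2t] : size ≡ p ℕ.^ (e ℕ.* (2 ℕ.* t))
    size≡p^[e*2t] = ≡.trans size≡q^[2t] (≡.trans (cong (ℕ._^ (2 ℕ.* t)) q≡pᵉ) (ℕP.^-*-assoc p e (2 ℕ.* t)))

  additive-qᵗ : Additive (q ℕ.^ t)
  additive-qᵗ = additive-^ additive-q t

  1<qᵗ : 1 < q ℕ.^ t
  1<qᵗ = ℕP.^-monoʳ-< q 1<q 1≤t

  module Fq  = FixedField additive-q 1≤q
  module Fqᵗ = FixedField additive-qᵗ (ℕP.<⇒≤ 1<qᵗ)
  open Fq using (Tr-cong; Tr-+; Tr-neg; Tr--; Tr-scale; Tr-fixed; monic-Tr)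

  InFq InFqᵗ : Carrier → Set
  InFq  = Fq.Fixed
  InFqᵗ = Fqᵗ.Fixed

  Fq⊆Fqᵗ : ∀ {c} → InFq c → InFqᵗ c
  Fq⊆Fqᵗ c∈Fq = Fq.fixed-^ c∈Fq t

  InSubfield-1⇒InFq : ∀ {x} → InSubfield K q 1 x → InFq x
  InSubfield-1⇒InFq {x} = ≡.subst (λ n → x ^ n ≈ x) (ℕP.*-identityʳ q)

  InFq⇒InSubfield-1 : ∀ {x} → InFq x → InSubfield K q 1 x
  InFq⇒InSubfield-1 {x} = ≡.subst (λ n → x ^ n ≈ x) (≡.sym (ℕP.*-identityʳ q))

  count-Fq : count Fq.fixed? ≡ q
  count-Fq = Fq.count-fixed {ℕ.pred (2 ℕ.* t)} 1<q (≡.trans size≡q^[2t] (cong (q ℕ.^_) 2t≡1+pred))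
    where
    2t≡1+pred : 2 ℕ.* t ≡ suc (ℕ.pred (2 ℕ.* t))
    2t≡1+pred = ≡.sym (ℕP.suc-pred (2 ℕ.* t) {{ℕ.>-nonZero (ℕP.≤-trans 1≤t (ℕP.m≤m+n t (t ℕ.+ 0)))}})

  count-Fqᵗ : count Fqᵗ.fixed? ≡ q ℕ.^ t
  count-Fqᵗ = Fqᵗ.count-fixed {1} 1<qᵗ
    (≡.trans size≡q^[2t] (≡.trans (cong (q ℕ.^_) (ℕP.*-comm 2 t)) (≡.sym (ℕP.^-*-assoc q t 2))))

  tr : Carrier → Carrier
  tr = Tr K q t

  tr-Fq : ∀ {u} → InFqᵗ u → InFq (tr u)
  tr-Fq = Tr-fixed t

  tr-Fqᵗ : ∀ {u} → InFqᵗ u → InFqᵗ (tr u)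
  tr-Fqᵗ = Fq⊆Fqᵗ ∘ tr-Fq

  Fqᵗ⊈zeros-tr : ¬ (∀ x → T (Fqᵗ.fixed? x) → T (zeros tr x))
  Fqᵗ⊈zeros-tr Fqᵗ⊆zeros = ℕP.<⇒≱ (begin-strict
    q ℕ.^ t′                   <⟨ ℕP.^-monoʳ-< q 1<q (ℕP.n<1+n t′) ⟩
    q ℕ.^ suc t′               ≡⟨ cong (q ℕ.^_) t≡1+t′ ⟨
    q ℕ.^ t                    ≡⟨ count-Fqᵗ ⟨
    count Fqᵗ.fixed?           ∎)
    (ℕP.≤-trans (count-mono Fqᵗ⊆zeros)
      (≡.subst (λ s → count (zeros (Tr K q s)) ≤ q ℕ.^ t′) (≡.sym t≡1+t′) (monic-roots≤degree (monic-Tr 1<q t′))))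
    where
    open ℕP.≤-Reasoning
    t′ = ℕ.pred t
    t≡1+t′ : t ≡ suc t′
    t≡1+t′ = ≡.sym (ℕP.suc-pred t {{ℕ.>-nonZero 1≤t}})

  nonzero-trace? : Pred
  nonzero-trace? w = Fqᵗ.fixed? w ∧ not (tr w ≈ᵇ 0#)

  tr-nonzero : ∃ λ w → InFqᵗ w × ¬ tr w ≈ 0#
  tr-nonzero with anyFin (nonzero-trace? ∘ enum) in any-witness
  ... | true = let (i , w-witness) = anyFin⇒∃ (nonzero-trace? ∘ enum) (≡.subst T (≡.sym any-witness) _)
                   (w∈Fqᵗ , trw≉0) = to T-∧ w-witness
               in enum i , ≈ᵇ⇒≈ w∈Fqᵗ , not-≈ᵇ⇒≉ trw≉0
  ... | false = ⊥-elim (Fqᵗ⊈zeros-tr Fqᵗ⊆zeros)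
    where
    Fqᵗ⊆zeros : ∀ x → T (Fqᵗ.fixed? x) → T (zeros tr x)
    Fqᵗ⊆zeros x x∈Fqᵗ with tr x ≟ 0#
    ... | yes _    = _
    ... | no trx≉0 = ≡.subst T any-witness (∃⇒anyFin (nonzero-trace? ∘ enum) (index x)
      (from T-∧ (Fqᵗ.fixed?-resp (≈-sym (enum-index x)) x∈Fqᵗ ,
                 ≉⇒not-≈ᵇ (trx≉0 ∘ ≈-trans (Tr-cong t (≈-sym (enum-index x)))))))

  tr-surjective : ∃ λ u₀ → InFqᵗ u₀ × tr u₀ ≈ 1#
  tr-surjective with w , w∈Fqᵗ , trw≉0 ← tr-nonzero =
    (tr w) ⁻¹ * w ,
    Fqᵗ.fixed-* (Fqᵗ.fixed-⁻¹ (tr-Fqᵗ w∈Fqᵗ)) w∈Fqᵗ ,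
    ≈-trans (Tr-scale t (Fq.fixed-⁻¹ (tr-Fq w∈Fqᵗ)) w) (x⁻¹*x≈1 trw≉0)

  module Basis (ξ : Carrier) (ξ∉Fqᵗ : ¬ InFqᵗ ξ) where

    basis-unique : ∀ {u₁ v₁ u₂ v₂} → InFqᵗ u₁ → InFqᵗ v₁ → InFqᵗ u₂ → InFqᵗ v₂ →
                   u₁ + ξ * v₁ ≈ u₂ + ξ * v₂ → u₁ ≈ u₂ × v₁ ≈ v₂
    basis-unique {u₁} {v₁} {u₂} {v₂} u₁∈ v₁∈ u₂∈ v₂∈ eq = by-cases ((v₂ - v₁) ≟ 0#)
      where
      open ≈-Reasoning
      u₁-u₂≈ξ[v₂-v₁] : u₁ - u₂ ≈ ξ * (v₂ - v₁)
      u₁-u₂≈ξ[v₂-v₁] = begin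
        u₁ - u₂
          ≈⟨ solve 5 (λ u₁ v₁ u₂ v₂ ξ → u₁ :- u₂ := ((u₁ :+ ξ :* v₁) :- (u₂ :+ ξ :* v₂)) :+ ξ :* (v₂ :- v₁)) ≈-refl u₁ v₁ u₂ v₂ ξ ⟩
        ((u₁ + ξ * v₁) - (u₂ + ξ * v₂)) + ξ * (v₂ - v₁)
          ≈⟨ +-congʳ (x≈y⇒x∙y⁻¹≈ε eq) ⟩
        0# + ξ * (v₂ - v₁)
          ≈⟨ +-identityˡ _ ⟩
        ξ * (v₂ - v₁) ∎
      by-cases : Dec (v₂ - v₁ ≈ 0#) → u₁ ≈ u₂ × v₁ ≈ v₂
      by-cases (yes v₂-v₁≈0) =
        x-y≈0⇒x≈y (≈-trans u₁-u₂≈ξ[v₂-v₁] (≈-trans (*-congˡ v₂-v₁≈0) (zeroʳ ξ))) , ≈-sym (x-y≈0⇒x≈y v₂-v₁≈0)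
      by-cases (no v₂-v₁≉0) = ⊥-elim (ξ∉Fqᵗ (Fqᵗ.fixed-resp ξ≈quotient
        (Fqᵗ.fixed-* (Fqᵗ.fixed-- u₁∈ u₂∈) (Fqᵗ.fixed-⁻¹ (Fqᵗ.fixed-- v₂∈ v₁∈)))))
        where
        ξ≈quotient : (u₁ - u₂) * (v₂ - v₁) ⁻¹ ≈ ξ
        ξ≈quotient = begin
          (u₁ - u₂) * (v₂ - v₁) ⁻¹          ≈⟨ *-congʳ u₁-u₂≈ξ[v₂-v₁] ⟩
          ξ * (v₂ - v₁) * (v₂ - v₁) ⁻¹      ≈⟨ *-assoc _ _ _ ⟩
          ξ * ((v₂ - v₁) * (v₂ - v₁) ⁻¹)    ≈⟨ *-congˡ (x*x⁻¹≈1 v₂-v₁≉0) ⟩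
          ξ * 1#                            ≈⟨ *-identityʳ ξ ⟩
          ξ                                 ∎

    σ : Carrier → Carrier
    σ x = x ^ (q ℕ.^ t)

    σ-involutive : ∀ x → σ (σ x) ≈ x
    σ-involutive x = begin
      σ (σ x)                       ≈⟨ ^-assocʳ x (q ℕ.^ t) (q ℕ.^ t) ⟩
      x ^ (q ℕ.^ t ℕ.* q ℕ.^ t)     ≡⟨ cong (x ^_) qᵗqᵗ≡size ⟩
      x ^ size                      ≈⟨ fermat x ⟩
      x                             ∎
      where
      open ≈-Reasoning
      qᵗqᵗ≡size : q ℕ.^ t ℕ.* q ℕ.^ t ≡ size
      qᵗqᵗ≡size = ≡.trans (≡.sym (ℕP.^-distribˡ-+-* q t t))
                          (≡.trans (cong (λ n → q ℕ.^ (t ℕ.+ n)) (≡.sym (ℕP.+-identityʳ t))) (≡.sym size≡q^[2t]))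

    σ-- : ∀ x y → σ (x - y) ≈ σ x - σ y
    σ-- x y = ≈-trans (^-distrib-+ additive-qᵗ x (- y)) (+-congˡ (additive-neg additive-qᵗ (ℕP.<⇒≤ 1<qᵗ) y))

    basis-exists : ∀ z → ∃ λ a → ∃ λ b → InFqᵗ a × InFqᵗ b × z ≈ a + b * ξ
    basis-exists z = z - b * ξ , b , a∈ , b∈ , solve 3 (λ z b ξ → z := (z :- b :* ξ) :+ b :* ξ) ≈-refl z b ξ
      where
      -- applying σ to z = a + b ξ gives z - σ z = b (ξ - σ ξ)
      open ≈-Reasoning
      d = ξ - σ ξ
      d≉0 : ¬ d ≈ 0#
      d≉0 d≈0 = ξ∉Fqᵗ (≈-sym (x-y≈0⇒x≈y d≈0))
      b = (z - σ z) * d ⁻¹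
      bd≈ : b * d ≈ z - σ z
      bd≈ = ≈-trans (*-assoc _ _ _) (≈-trans (*-congˡ (x⁻¹*x≈1 d≉0)) (*-identityʳ _))
      σd≈-d : σ d ≈ - d
      σd≈-d = begin
        σ (ξ - σ ξ)        ≈⟨ σ-- ξ (σ ξ) ⟩
        σ ξ - σ (σ ξ)      ≈⟨ +-congˡ (-‿cong (σ-involutive ξ)) ⟩
        σ ξ - ξ            ≈⟨ solve 2 (λ x y → y :- x := :- (x :- y)) ≈-refl ξ (σ ξ) ⟩
        - d                ∎
      [-d]⁻¹≈-d⁻¹ : (- d) ⁻¹ ≈ - (d ⁻¹)
      [-d]⁻¹≈-d⁻¹ = ⁻¹-unique (≈-trans (solve 2 (λ d i → (:- d) :* (:- i) := d :* i) ≈-refl d (d ⁻¹)) (x*x⁻¹≈1 d≉0))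
      b∈ : InFqᵗ b
      b∈ = begin
        σ ((z - σ z) * d ⁻¹)       ≈⟨ ^-distrib-* _ _ (q ℕ.^ t) ⟩
        σ (z - σ z) * σ (d ⁻¹)     ≈⟨ *-cong (≈-trans (σ-- z (σ z)) (+-congˡ (-‿cong (σ-involutive z))))
                                             (≈-trans (⁻¹-^ d (q ℕ.^ t)) (≈-trans (⁻¹-cong σd≈-d) [-d]⁻¹≈-d⁻¹)) ⟩
        (σ z - z) * - (d ⁻¹)       ≈⟨ solve 3 (λ x y i → (x :- y) :* (:- i) := (y :- x) :* i) ≈-refl (σ z) z (d ⁻¹) ⟩
        (z - σ z) * d ⁻¹           ∎
      a∈ : InFqᵗ (z - b * ξ)
      a∈ = begin
        σ (z - b * ξ)
          ≈⟨ ≈-trans (σ-- z (b * ξ)) (+-congˡ (-‿cong (≈-trans (^-distrib-* b ξ (q ℕ.^ t)) (*-congʳ b∈)))) ⟩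
        σ z - b * σ ξ
          ≈⟨ +-congʳ (≈-sym (≈-trans (+-congˡ (-‿cong bd≈)) (solve 2 (λ z s → z :- (z :- s) := s) ≈-refl z (σ z)))) ⟩
        (z - b * d) - b * σ ξ
          ≈⟨ solve 4 (λ z b ξ s → (z :- b :* (ξ :- s)) :- b :* s := z :- b :* ξ) ≈-refl z b ξ (σ ξ) ⟩
        z - b * ξ ∎

    S? : Pred
    S? = inS? K q t ξ

    S-intro : ∀ {u x} → InFqᵗ u → x ≈ u + ξ * tr u → T (S? x)
    S-intro {u} {x} u∈ x≈ = ∃⇒anyFin _ (index u)
      (from T-∧ (≈⇒≈ᵇ (Fqᵗ.fixed-resp (≈-sym (enum-index u)) u∈) ,
                 ≈⇒≈ᵇ (≈-trans x≈ (+-cong (≈-sym (enum-index u)) (*-congˡ (Tr-cong t (≈-sym (enum-index u))))))))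

    S-elim : ∀ {x} → T (S? x) → ∃ λ u → InFqᵗ u × x ≈ u + ξ * tr u
    S-elim x∈S with i , h ← anyFin⇒∃ _ x∈S = let (u∈ , x≈) = to T-∧ h in enum i , ≈ᵇ⇒≈ u∈ , ≈ᵇ⇒≈ x≈

    S-resp : Respects≈ S?
    S-resp x≈y x∈S with u , u∈ , x≈ ← S-elim x∈S = S-intro u∈ (≈-trans (≈-sym x≈y) x≈)

    W? : Carrier → Pred
    W? α x = S? x ∧ S? (α * x)

    W-resp : ∀ α → Respects≈ (W? α)
    W-resp α x≈y x∈W = let (x∈S , αx∈S) = to T-∧ x∈W in from T-∧ (S-resp x≈y x∈S , S-resp (*-congˡ x≈y) αx∈S)

    InL⇒W : ∀ {α} → InL K q t ξ α → ∃ λ x₀ → T (W? α x₀) × ¬ x₀ ≈ 0#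
    InL⇒W {α} (x , y , (u , u∈ , x≈) , (v , v∈ , y≈) , ¬x≈0×y≈0 , y≈αx) =
      x , from T-∧ (S-intro u∈ x≈ , S-resp y≈αx (S-intro v∈ y≈)) ,
      λ x≈0 → ¬x≈0×y≈0 (x≈0 , ≈-trans y≈αx (≈-trans (*-congˡ x≈0) (zeroʳ α)))

    pointCount≡count-W : ∀ α → pointCount K q t ξ α ≡ count (W? α)
    pointCount≡count-W α = begin
      pointCount K q t ξ α
        ≡⟨ sumFin≡sum (λ i → countFin (λ j → S? (enum i) ∧ S? (enum j) ∧ (enum j ≈ᵇ α * enum i))) ⟩
      sum (λ i → countFin (λ j → S? (enum i) ∧ S? (enum j) ∧ (enum j ≈ᵇ α * enum i)))
                                                ≡⟨ sum-cong-≗ (λ i → row (enum i)) ⟩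
      sum (iverson ∘ W? α ∘ enum)
        ≡⟨ count≡sum (W? α) ⟨
      count (W? α) ∎
      where
      open ≡.≡-Reasoning
      row : ∀ x → countFin (λ j → S? x ∧ S? (enum j) ∧ (enum j ≈ᵇ α * x)) ≡ iverson (W? α x)
      row x with S? x
      ... | true  = count-∧-≈ᵇ S-resp (α * x)
      ... | false = countFin-none {size} (λ _ → false) (λ _ ())

    count-S : count S? ≡ q ℕ.^ t
    count-S = ≡.trans (≡.sym (count-bijection coordinates)) count-Fqᵗ
      where
      coordinates : IsBijection Fqᵗ.fixed? S? (λ u → u + ξ * tr u)
      coordinates = record
        { D-resp = Fqᵗ.fixed?-resp
        ; E-resp = S-resp
        ; f-cong = λ u≈v → +-cong u≈v (*-congˡ (Tr-cong t u≈v))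
        ; f-inj  = λ u∈ v∈ eq → let u∈′ = ≈ᵇ⇒≈ u∈ ; v∈′ = ≈ᵇ⇒≈ v∈ in
            proj₁ (basis-unique u∈′ (tr-Fqᵗ u∈′) v∈′ (tr-Fqᵗ v∈′) eq)
        ; f-into = λ u∈ → S-intro (≈ᵇ⇒≈ u∈) ≈-refl
        ; f-onto = λ y∈S → let (u , u∈ , y≈) = S-elim y∈S in u , ≈⇒≈ᵇ u∈ , ≈-sym y≈
        }

    S-scale : ∀ {c x} → InFq c → T (S? x) → T (S? (c * x))
    S-scale {c} {x} c∈Fq x∈S with u , u∈ , x≈ ← S-elim x∈S =
      S-intro (Fqᵗ.fixed-* (Fq⊆Fqᵗ c∈Fq) u∈) (begin
        c * x                      ≈⟨ *-congˡ x≈ ⟩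
        c * (u + ξ * tr u)         ≈⟨ solve 4 (λ c u ξ s → c :* (u :+ ξ :* s) := c :* u :+ ξ :* (c :* s)) ≈-refl c u ξ (tr u) ⟩
        c * u + ξ * (c * tr u)     ≈⟨ +-congˡ (*-congˡ (Tr-scale t c∈Fq u)) ⟨
        c * u + ξ * tr (c * u)     ∎)
      where open ≈-Reasoning

    count-W≡q^t : ∀ {α} → InFq α → count (W? α) ≡ q ℕ.^ t
    count-W≡q^t {α} α∈Fq = ≡.trans
      (count-cong {W? α} {S?} (λ x x∈W → proj₁ (to T-∧ x∈W)) (λ x x∈S → from T-∧ (x∈S , S-scale α∈Fq x∈S)))
      count-S

    trace-zero⇒S : ∀ {u} → InFqᵗ u → tr u ≈ 0# → T (S? u)
    trace-zero⇒S {u} u∈ tru≈0 = S-intro u∈ (≈-sym (≈-trans (+-congˡ (≈-trans (*-congˡ tru≈0) (zeroʳ ξ))) (+-identityʳ u)))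

    module InsideFqᵗ {α} (α∈Fqᵗ : InFqᵗ α) (α∉Fq : ¬ InFq α) where

      tr-zero? : Pred
      tr-zero? x = Fqᵗ.fixed? x ∧ (tr x ≈ᵇ 0#)

      tr-α-zero? : Pred
      tr-α-zero? x = tr-zero? x ∧ (tr (α * x) ≈ᵇ 0#)

      tr-α*≈α*tr : ∀ {u} → InFqᵗ u → T (S? (α * (u + ξ * tr u))) → tr (α * u) ≈ α * tr u
      tr-α*≈α*tr {u} u∈ αx∈S with v , v∈ , αx≈ ← S-elim αx∈S =
        let (v≈αu , trv≈αtru) = basis-unique v∈ (tr-Fqᵗ v∈) (Fqᵗ.fixed-* α∈Fqᵗ u∈) (Fqᵗ.fixed-* α∈Fqᵗ (tr-Fqᵗ u∈)) (begin
              v + ξ * tr v             ≈⟨ αx≈ ⟨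
              α * (u + ξ * tr u)       ≈⟨ solve 4 (λ α u ξ s → α :* (u :+ ξ :* s) := α :* u :+ ξ :* (α :* s)) ≈-refl α u ξ (tr u) ⟩
              α * u + ξ * (α * tr u)   ∎)
        in ≈-trans (Tr-cong t (≈-sym v≈αu)) trv≈αtru
        where open ≈-Reasoning

      W⊆tr-α-zero : ∀ x → T (W? α x) → T (tr-α-zero? x)
      W⊆tr-α-zero x x∈W
        with x∈S , αx∈S ← to T-∧ x∈W
        with u , u∈ , x≈ ← S-elim x∈S
        with tr u ≟ 0#
      ... | no tru≉0 =
        ⊥-elim (α∉Fq (Fq.fixed-resp α≈ (Fq.fixed-* (tr-Fq (Fqᵗ.fixed-* α∈Fqᵗ u∈)) (Fq.fixed-⁻¹ (tr-Fq u∈)))))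
        where
        α≈ : tr (α * u) * (tr u) ⁻¹ ≈ α
        α≈ = ≈-trans (*-congʳ (tr-α*≈α*tr u∈ (S-resp (*-congˡ x≈) αx∈S)))
               (≈-trans (*-assoc _ _ _) (≈-trans (*-congˡ (x*x⁻¹≈1 tru≉0)) (*-identityʳ α)))
      ... | yes tru≈0 =
        from T-∧ (from T-∧ (≈⇒≈ᵇ (Fqᵗ.fixed-resp (≈-sym x≈u) u∈) , ≈⇒≈ᵇ (≈-trans (Tr-cong t x≈u) tru≈0)) ,
                  ≈⇒≈ᵇ trαx≈0)
        where
        open ≈-Reasoning
        x≈u : x ≈ u
        x≈u = ≈-trans x≈ (≈-trans (+-congˡ (≈-trans (*-congˡ tru≈0) (zeroʳ ξ))) (+-identityʳ u))
        trαx≈0 : tr (α * x) ≈ 0#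
        trαx≈0 = begin
          tr (α * x)      ≈⟨ Tr-cong t (*-congˡ x≈u) ⟩
          tr (α * u)      ≈⟨ tr-α*≈α*tr u∈ (S-resp (*-congˡ x≈) αx∈S) ⟩
          α * tr u        ≈⟨ *-congˡ tru≈0 ⟩
          α * 0#          ≈⟨ zeroʳ α ⟩
          0#              ∎

      tr-α-zero⊆W : ∀ x → T (tr-α-zero? x) → T (W? α x)
      tr-α-zero⊆W x x∈tr-α-zero with x∈tr-zero , trαx≈0 ← to T-∧ x∈tr-α-zero with x∈ , trx≈0 ← to T-∧ x∈tr-zero =
        from T-∧ (trace-zero⇒S (≈ᵇ⇒≈ x∈) (≈ᵇ⇒≈ trx≈0) , trace-zero⇒S (Fqᵗ.fixed-* α∈Fqᵗ (≈ᵇ⇒≈ x∈)) (≈ᵇ⇒≈ trαx≈0))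

      u₀ = proj₁ tr-surjective
      u₀∈ = proj₁ (proj₂ tr-surjective)
      tru₀≈1 = proj₂ (proj₂ tr-surjective)

      β = tr (α * u₀)
      β∈Fq : InFq β
      β∈Fq = tr-Fq (Fqᵗ.fixed-* α∈Fqᵗ u₀∈)

      α-β≉0 : ¬ α - β ≈ 0#
      α-β≉0 α-β≈0 = α∉Fq (Fq.fixed-resp (≈-sym (x-y≈0⇒x≈y α-β≈0)) β∈Fq)

      w = (α - β) ⁻¹ * u₀
      w∈ : InFqᵗ w
      w∈ = Fqᵗ.fixed-* (Fqᵗ.fixed-⁻¹ (Fqᵗ.fixed-- α∈Fqᵗ (Fq⊆Fqᵗ β∈Fq))) u₀∈

      -- u₁ shows that x ↦ tr (α x) maps tr-zero? onto Fq.
      u₁ = w - tr w * u₀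
      trw∈Fq = tr-Fq w∈
      u₁∈ : InFqᵗ u₁
      u₁∈ = Fqᵗ.fixed-- w∈ (Fqᵗ.fixed-* (Fq⊆Fqᵗ trw∈Fq) u₀∈)

      tru₁≈0 : tr u₁ ≈ 0#
      tru₁≈0 = begin
        tr (w - tr w * u₀)        ≈⟨ Tr-- t _ _ ⟩
        tr w - tr (tr w * u₀)     ≈⟨ +-congˡ (-‿cong (Tr-scale t trw∈Fq u₀)) ⟩
        tr w - tr w * tr u₀       ≈⟨ +-congˡ (-‿cong (≈-trans (*-congˡ tru₀≈1) (*-identityʳ _))) ⟩
        tr w - tr w               ≈⟨ -‿inverseʳ _ ⟩
        0#                        ∎
        where open ≈-Reasoning

      αw≈ : α * w ≈ u₀ + β * w
      αw≈ = begin
        α * ((α - β) ⁻¹ * u₀)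
          ≈⟨ solve 4 (λ α β g u → α :* (g :* u) := (α :- β) :* g :* u :+ β :* (g :* u)) ≈-refl α β ((α - β) ⁻¹) u₀ ⟩
        (α - β) * (α - β) ⁻¹ * u₀ + β * w
          ≈⟨ +-congʳ (≈-trans (*-congʳ (x*x⁻¹≈1 α-β≉0)) (*-identityˡ u₀)) ⟩
        u₀ + β * w ∎
        where open ≈-Reasoning

      trαu₁≈1 : tr (α * u₁) ≈ 1#
      trαu₁≈1 = begin
        tr (α * (w - tr w * u₀))
          ≈⟨ Tr-cong t (solve 4 (λ α w c u → α :* (w :- c :* u) := α :* w :- c :* (α :* u)) ≈-refl α w (tr w) u₀) ⟩
        tr (α * w - tr w * (α * u₀))
          ≈⟨ Tr-- t _ _ ⟩
        tr (α * w) - tr (tr w * (α * u₀))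
          ≈⟨ +-cong (Tr-cong t αw≈) (-‿cong (Tr-scale t trw∈Fq _)) ⟩
        tr (u₀ + β * w) - tr w * β
          ≈⟨ +-congʳ (≈-trans (Tr-+ t _ _) (+-cong tru₀≈1 (Tr-scale t β∈Fq w))) ⟩
        (1# + β * tr w) - tr w * β
          ≈⟨ solve 3 (λ o b c → (o :+ b :* c) :- c :* b := o) ≈-refl 1# β (tr w) ⟩
        1# ∎
        where open ≈-Reasoning

      tr-surjection : IsAdditiveSurjection Fqᵗ.fixed? Fq.fixed? tr
      tr-surjection = record
        { D-resp = Fqᵗ.fixed?-resp
        ; E-resp = Fq.fixed?-resp
        ; f-cong = Tr-cong t
        ; D-+    = λ x∈ y∈ → ≈⇒≈ᵇ (Fqᵗ.fixed-+ (≈ᵇ⇒≈ x∈) (≈ᵇ⇒≈ y∈))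
        ; D-neg  = λ x∈ → ≈⇒≈ᵇ (Fqᵗ.fixed-neg (≈ᵇ⇒≈ x∈))
        ; f-+    = λ _ _ → Tr-+ t _ _
        ; f-neg  = λ _ → Tr-neg t _
        ; f-into = λ x∈ → ≈⇒≈ᵇ (tr-Fq (≈ᵇ⇒≈ x∈))
        ; f-onto = λ {y} y∈ → let y∈′ = ≈ᵇ⇒≈ y∈ in
            y * u₀ , ≈⇒≈ᵇ (Fqᵗ.fixed-* (Fq⊆Fqᵗ y∈′) u₀∈) ,
            ≈-trans (Tr-scale t y∈′ u₀) (≈-trans (*-congˡ tru₀≈1) (*-identityʳ y))
        }

      tr-α-surjection : IsAdditiveSurjection tr-zero? Fq.fixed? (λ x → tr (α * x))
      tr-α-surjection = record
        { D-resp = IsAdditiveSurjection.kernel-resp tr-surjection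
        ; E-resp = Fq.fixed?-resp
        ; f-cong = Tr-cong t ∘ *-congˡ
        ; D-+    = λ {x} {y} x∈ y∈ → let (x∈′ , trx≈0) = to T-∧ x∈ ; (y∈′ , try≈0) = to T-∧ y∈ in
            from T-∧ (≈⇒≈ᵇ (Fqᵗ.fixed-+ (≈ᵇ⇒≈ x∈′) (≈ᵇ⇒≈ y∈′)) ,
                      ≈⇒≈ᵇ (≈-trans (Tr-+ t x y) (≈-trans (+-cong (≈ᵇ⇒≈ trx≈0) (≈ᵇ⇒≈ try≈0)) (+-identityʳ 0#))))
        ; D-neg  = λ {x} x∈ → let (x∈′ , trx≈0) = to T-∧ x∈ in
            from T-∧ (≈⇒≈ᵇ (Fqᵗ.fixed-neg (≈ᵇ⇒≈ x∈′)) ,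
                      ≈⇒≈ᵇ (≈-trans (Tr-neg t x) (≈-trans (-‿cong (≈ᵇ⇒≈ trx≈0)) -0#≈0#)))
        ; f-+    = λ {x} {y} _ _ → ≈-trans (Tr-cong t (distribˡ α x y)) (Tr-+ t _ _)
        ; f-neg  = λ {x} _ → ≈-trans (Tr-cong t (≈-sym (-‿distribʳ-* α x))) (Tr-neg t _)
        ; f-into = λ x∈ → ≈⇒≈ᵇ (tr-Fq (Fqᵗ.fixed-* α∈Fqᵗ (≈ᵇ⇒≈ (proj₁ (to T-∧ x∈)))))
        ; f-onto = λ {y} y∈ → let y∈′ = ≈ᵇ⇒≈ y∈ in
            y * u₁ ,
            from T-∧ (≈⇒≈ᵇ (Fqᵗ.fixed-* (Fq⊆Fqᵗ y∈′) u₁∈) ,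
                      ≈⇒≈ᵇ (≈-trans (Tr-scale t y∈′ u₁) (≈-trans (*-congˡ tru₁≈0) (zeroʳ y)))) ,
            (begin
              tr (α * (y * u₁))   ≈⟨ Tr-cong t (solve 3 (λ a y u → a :* (y :* u) := y :* (a :* u)) ≈-refl α y u₁) ⟩
              tr (y * (α * u₁))   ≈⟨ Tr-scale t y∈′ _ ⟩
              y * tr (α * u₁)     ≈⟨ *-congˡ trαu₁≈1 ⟩
              y * 1#              ≈⟨ *-identityʳ y ⟩
              y                   ∎)
        }
        where open ≈-Reasoning

      count-tr-α-zero : count tr-α-zero? ℕ.* q ℕ.^ 2 ≡ q ℕ.^ t
      count-tr-α-zero = begin
        count tr-α-zero? ℕ.* q ℕ.^ 2                             ≡⟨ cong (λ n → count tr-α-zero? ℕ.* (q ℕ.* n)) (ℕP.*-identityʳ q) ⟩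
        count tr-α-zero? ℕ.* (q ℕ.* q)                           ≡⟨ ℕP.*-assoc (count tr-α-zero?) q q ⟨
        count tr-α-zero? ℕ.* q ℕ.* q                             ≡⟨ cong₂ (λ m n → count tr-α-zero? ℕ.* m ℕ.* n) count-Fq count-Fq ⟨
        count tr-α-zero? ℕ.* count Fq.fixed? ℕ.* count Fq.fixed? ≡⟨ cong (ℕ._* count Fq.fixed?) (count-kernel-image tr-α-surjection) ⟨
        count tr-zero? ℕ.* count Fq.fixed?               ≡⟨ count-kernel-image tr-surjection ⟨
        count Fqᵗ.fixed?                                 ≡⟨ count-Fqᵗ ⟩
        q ℕ.^ t                                          ∎
        where open ≡.≡-Reasoning

      2≤t : 2 ≤ t
      2≤t = ℕP.≤∧≢⇒< 1≤t λ 1≡t → α∉Fq (≡.subst (λ n → α ^ n ≈ α) (≡.trans (cong (q ℕ.^_) (≡.sym 1≡t)) (ℕP.*-identityʳ q)) α∈Fqᵗ)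

      count-W≡q^[t∸2] : count (W? α) ≡ q ℕ.^ (t ℕ.∸ 2)
      count-W≡q^[t∸2] = ≡.trans (count-cong W⊆tr-α-zero tr-α-zero⊆W)
        (ℕP.*-cancelʳ-≡ (count tr-α-zero?) (q ℕ.^ (t ℕ.∸ 2)) (q ℕ.^ 2) {{ℕP.m^n≢0 q 2 {{ℕ.>-nonZero 1≤q}}}} (begin
          count tr-α-zero? ℕ.* q ℕ.^ 2             ≡⟨ count-tr-α-zero ⟩
          q ℕ.^ t                          ≡⟨ cong (q ℕ.^_) (ℕP.m∸n+n≡m 2≤t) ⟨
          q ℕ.^ (t ℕ.∸ 2 ℕ.+ 2)            ≡⟨ ℕP.^-distribˡ-+-* q (t ℕ.∸ 2) 2 ⟩
          q ℕ.^ (t ℕ.∸ 2) ℕ.* q ℕ.^ 2      ∎))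
        where open ≡.≡-Reasoning

    module OutsideFqᵗ {A B} (A∈ : InFqᵗ A) (B∈ : InFqᵗ B) (ξ²≈ : ξ * ξ ≈ A * ξ + B)
                      (trA≉-2 : ¬ tr A ≈ - (1# + 1#)) {α} (α∉Fqᵗ : ¬ InFqᵗ α) where

      a = proj₁ (basis-exists α)
      b = proj₁ (proj₂ (basis-exists α))
      a∈ : InFqᵗ a
      a∈ = proj₁ (proj₂ (proj₂ (basis-exists α)))
      b∈ : InFqᵗ b
      b∈ = proj₁ (proj₂ (proj₂ (proj₂ (basis-exists α))))
      α≈a+bξ : α ≈ a + b * ξ
      α≈a+bξ = proj₂ (proj₂ (proj₂ (proj₂ (basis-exists α))))

      b≉0 : ¬ b ≈ 0#
      b≉0 b≈0 = α∉Fqᵗ (Fqᵗ.fixed-resp (≈-sym α≈a) a∈)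
        where
        α≈a : α ≈ a
        α≈a = ≈-trans α≈a+bξ (≈-trans (+-congˡ (≈-trans (*-congʳ b≈0) (zeroˡ ξ))) (+-identityʳ a))

      c₁ = tr (b * B) - a - b * A

      Constrained : Carrier → Set
      Constrained u = InFqᵗ u × b * u ≈ tr (a * u) + tr u * c₁

      α*-expansion : ∀ {x u} → x ≈ u + ξ * tr u →
                     α * x ≈ (a * u + tr u * (b * B)) + ξ * (a * tr u + b * u + b * tr u * A)
      α*-expansion {x} {u} x≈ = begin
        α * x
          ≈⟨ *-cong α≈a+bξ x≈ ⟩
        (a + b * ξ) * (u + ξ * τ)
          ≈⟨ solve 7 (λ a b ξ u τ A B → (a :+ b :* ξ) :* (u :+ ξ :* τ) :=
                                          ((a :* u :+ τ :* (b :* B)) :+ ξ :* (a :* τ :+ b :* u :+ b :* τ :* A)) :+ b :* τ :* (ξ :* ξ :- (A :* ξ :+ B)))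
                                          ≈-refl a b ξ u τ A B ⟩
        ((a * u + τ * (b * B)) + ξ * (a * τ + b * u + b * τ * A)) + b * τ * (ξ * ξ - (A * ξ + B))
                                     ≈⟨ +-congˡ (≈-trans (*-congˡ (x≈y⇒x∙y⁻¹≈ε ξ²≈)) (zeroʳ _)) ⟩
        ((a * u + τ * (b * B)) + ξ * (a * τ + b * u + b * τ * A)) + 0#
                                     ≈⟨ +-identityʳ _ ⟩
        (a * u + τ * (b * B)) + ξ * (a * τ + b * u + b * τ * A) ∎
        where
        open ≈-Reasoning
        τ = tr u

      -- Compare the coordinates of α x = v + ξ tr v with those given by α*-expansion.
      W-coordinates : ∀ {x} → T (W? α x) → ∃ λ u → Constrained u × x ≈ u + ξ * tr u
      W-coordinates {x} x∈W
        with x∈S , αx∈S ← to T-∧ x∈W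
        with u , u∈ , x≈ ← S-elim x∈S
        with v , v∈ , αx≈ ← S-elim αx∈S
        = u , (u∈ , bu≈) , x≈
        where
        open ≈-Reasoning
        τ = tr u
        τ∈Fq = tr-Fq u∈
        τ∈ = Fq⊆Fqᵗ τ∈Fq
        coordinates = basis-unique v∈ (tr-Fqᵗ v∈)
          (Fqᵗ.fixed-+ (Fqᵗ.fixed-* a∈ u∈) (Fqᵗ.fixed-* τ∈ (Fqᵗ.fixed-* b∈ B∈)))
          (Fqᵗ.fixed-+ (Fqᵗ.fixed-+ (Fqᵗ.fixed-* a∈ τ∈) (Fqᵗ.fixed-* b∈ u∈)) (Fqᵗ.fixed-* (Fqᵗ.fixed-* b∈ τ∈) A∈))
          (≈-trans (≈-sym αx≈) (α*-expansion x≈))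
        second-coordinate : a * τ + b * u + b * τ * A ≈ tr (a * u) + τ * tr (b * B)
        second-coordinate = begin
          a * τ + b * u + b * τ * A            ≈⟨ proj₂ coordinates ⟨
          tr v                                 ≈⟨ Tr-cong t (proj₁ coordinates) ⟩
          tr (a * u + τ * (b * B))             ≈⟨ Tr-+ t _ _ ⟩
          tr (a * u) + tr (τ * (b * B))        ≈⟨ +-congˡ (Tr-scale t τ∈Fq _) ⟩
          tr (a * u) + τ * tr (b * B)          ∎
        bu≈ : b * u ≈ tr (a * u) + τ * c₁
        bu≈ = begin
          b * u
            ≈⟨ solve 5 (λ a τ b u A → b :* u := (a :* τ :+ b :* u :+ b :* τ :* A) :- a :* τ :- b :* τ :* A) ≈-refl a τ b u A ⟩
          (a * τ + b * u + b * τ * A) - a * τ - b * τ * A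
            ≈⟨ +-congʳ (+-congʳ second-coordinate) ⟩
          (tr (a * u) + τ * tr (b * B)) - a * τ - b * τ * A
            ≈⟨ solve 6 (λ s τ y a b A → (s :+ τ :* y) :- a :* τ :- b :* τ :* A := s :+ τ :* (y :- a :- b :* A)) ≈-refl (tr (a * u)) τ (tr (b * B)) a b A ⟩
          tr (a * u) + τ * c₁ ∎

      r₁₁ = tr (b ⁻¹)
      r₁₂ = tr (b ⁻¹ * c₁) - 1#
      r₂₁ = tr (a * b ⁻¹) - 1#
      r₂₂ = tr (a * (b ⁻¹ * c₁))

      -- u = s b⁻¹ + τ b⁻¹ c₁ with s = tr (a u) and τ = tr u in Fq; apply tr and tr (a ·) to it.
      constraint-equations : ∀ {u} → Constrained u →
        (r₁₁ * tr (a * u) + r₁₂ * tr u ≈ 0#) × (r₂₁ * tr (a * u) + r₂₂ * tr u ≈ 0#)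
      constraint-equations {u} (u∈ , bu≈) = first , second
        where
        open ≈-Reasoning
        s = tr (a * u)
        τ = tr u
        s∈Fq = tr-Fq (Fqᵗ.fixed-* a∈ u∈)
        τ∈Fq = tr-Fq u∈
        u≈ : u ≈ s * b ⁻¹ + τ * (b ⁻¹ * c₁)
        u≈ = begin
          u                            ≈⟨ ≈-trans (*-congʳ (x⁻¹*x≈1 b≉0)) (*-identityˡ u) ⟨
          b ⁻¹ * b * u                 ≈⟨ *-assoc _ _ _ ⟩
          b ⁻¹ * (b * u)               ≈⟨ *-congˡ bu≈ ⟩
          b ⁻¹ * (s + τ * c₁)          ≈⟨ solve 4 (λ i s τ c → i :* (s :+ τ :* c) := s :* i :+ τ :* (i :* c)) ≈-refl (b ⁻¹) s τ c₁ ⟩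
          s * b ⁻¹ + τ * (b ⁻¹ * c₁)   ∎
        tr-linear : ∀ y z → tr (s * y + τ * z) ≈ s * tr y + τ * tr z
        tr-linear y z = ≈-trans (Tr-+ t _ _) (+-cong (Tr-scale t s∈Fq y) (Tr-scale t τ∈Fq z))
        τ≈ : τ ≈ s * r₁₁ + τ * tr (b ⁻¹ * c₁)
        τ≈ = ≈-trans (Tr-cong t u≈) (tr-linear _ _)
        s≈ : s ≈ s * tr (a * b ⁻¹) + τ * r₂₂
        s≈ = ≈-trans (Tr-cong t (≈-trans (*-congˡ u≈)
               (solve 5 (λ a s i τ c → a :* (s :* i :+ τ :* (i :* c)) := s :* (a :* i) :+ τ :* (a :* (i :* c))) ≈-refl a s (b ⁻¹) τ c₁)))
             (tr-linear _ _)
        first : r₁₁ * s + r₁₂ * τ ≈ 0#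
        first = begin
          r₁₁ * s + (tr (b ⁻¹ * c₁) - 1#) * τ
            ≈⟨ solve 5 (λ r s y τ o → r :* s :+ (y :- o) :* τ := (s :* r :+ τ :* y) :- o :* τ) ≈-refl r₁₁ s (tr (b ⁻¹ * c₁)) τ 1# ⟩
          (s * r₁₁ + τ * tr (b ⁻¹ * c₁)) - 1# * τ ≈⟨ +-cong (≈-sym τ≈) (-‿cong (*-identityˡ τ)) ⟩
          τ - τ
            ≈⟨ -‿inverseʳ τ ⟩
          0# ∎
        second : r₂₁ * s + r₂₂ * τ ≈ 0#
        second = begin
          (tr (a * b ⁻¹) - 1#) * s + r₂₂ * τ
            ≈⟨ solve 5 (λ y s r τ o → (y :- o) :* s :+ r :* τ := (s :* y :+ τ :* r) :- o :* s) ≈-refl (tr (a * b ⁻¹)) s r₂₂ τ 1# ⟩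
          (s * tr (a * b ⁻¹) + τ * r₂₂) - 1# * s
            ≈⟨ +-cong (≈-sym s≈) (-‿cong (*-identityˡ s)) ⟩
          s - s
            ≈⟨ -‿inverseʳ s ⟩
          0# ∎

      -- tr (b⁻¹ c₁) = tr (b B) r₁₁ - tr (a b⁻¹) - tr A, so r₁₁ = r₂₁ = r₁₂ = 0 would force tr A = -2.
      not-all-zero : r₁₁ ≈ 0# → r₂₁ ≈ 0# → r₁₂ ≈ 0# → ⊥
      not-all-zero r₁₁≈0 r₂₁≈0 r₁₂≈0 = trA≉-2 (begin
        tr A
          ≈⟨ solve 3 (λ x y z → z := (x :- y) :- ((x :- y) :- z)) ≈-refl (tr (b * B) * r₁₁) (tr (a * b ⁻¹)) (tr A) ⟩
        (X - tr (a * b ⁻¹)) - (X - tr (a * b ⁻¹) - tr A)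
                                                    ≈⟨ +-congˡ (-‿cong tr[b⁻¹c₁]≈) ⟨
        (X - tr (a * b ⁻¹)) - tr (b ⁻¹ * c₁)
          ≈⟨ +-cong (+-cong (≈-trans (*-congˡ r₁₁≈0) (zeroʳ _)) (-‿cong (x-y≈0⇒x≈y r₂₁≈0))) (-‿cong (x-y≈0⇒x≈y r₁₂≈0)) ⟩
        (0# - 1#) - 1#
          ≈⟨ +-congʳ (+-identityˡ _) ⟩
        - 1# - 1#
          ≈⟨ -‿+-comm 1# 1# ⟩
        - (1# + 1#) ∎)
        where
        open ≈-Reasoning
        X = tr (b * B) * r₁₁
        tr[b⁻¹c₁]≈ : tr (b ⁻¹ * c₁) ≈ X - tr (a * b ⁻¹) - tr A
        tr[b⁻¹c₁]≈ = begin
          tr (b ⁻¹ * c₁)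
            ≈⟨ Tr-cong t (solve 5 (λ i y a b A → i :* (y :- a :- b :* A) := y :* i :- a :* i :- (i :* b) :* A)
                                                                          ≈-refl (b ⁻¹) (tr (b * B)) a b A) ⟩
          tr (tr (b * B) * b ⁻¹ - a * b ⁻¹ - b ⁻¹ * b * A)
            ≈⟨ Tr-cong t (+-congˡ (-‿cong (≈-trans (*-congʳ (x⁻¹*x≈1 b≉0)) (*-identityˡ A)))) ⟩
          tr (tr (b * B) * b ⁻¹ - a * b ⁻¹ - A)
            ≈⟨ ≈-trans (Tr-- t _ _) (+-congʳ (Tr-- t _ _)) ⟩
          tr (tr (b * B) * b ⁻¹) - tr (a * b ⁻¹) - tr A
            ≈⟨ +-congʳ (+-congʳ (Tr-scale t (tr-Fq (Fqᵗ.fixed-* b∈ B∈)) (b ⁻¹))) ⟩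
          X - tr (a * b ⁻¹) - tr A ∎

      annihilator : ∃ λ ρ₁ → ∃ λ ρ₂ → ¬ (ρ₁ ≈ 0# × ρ₂ ≈ 0#) ×
                    (∀ {u} → Constrained u → ρ₁ * tr (a * u) + ρ₂ * tr u ≈ 0#)
      annihilator with r₁₁ ≟ 0# | r₁₂ ≟ 0#
      ... | yes r₁₁≈0 | yes r₁₂≈0 =
        r₂₁ , r₂₂ , (λ (r₂₁≈0 , _) → not-all-zero r₁₁≈0 r₂₁≈0 r₁₂≈0) , proj₂ ∘ constraint-equations
      ... | yes _     | no r₁₂≉0 = r₁₁ , r₁₂ , r₁₂≉0 ∘ proj₂ , proj₁ ∘ constraint-equations
      ... | no r₁₁≉0 | _         = r₁₁ , r₁₂ , r₁₁≉0 ∘ proj₁ , proj₁ ∘ constraint-equations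

      module _ {x₀} (x₀∈W : T (W? α x₀)) (x₀≉0 : ¬ x₀ ≈ 0#) where

        coordinates≉0 : ∀ {u₀} → Constrained u₀ → x₀ ≈ u₀ + ξ * tr u₀ → ¬ (tr (a * u₀) ≈ 0# × tr u₀ ≈ 0#)
        coordinates≉0 {u₀} (_ , bu₀≈) x₀≈ (s₀≈0 , τ₀≈0) = x₀≉0 (begin
          x₀                   ≈⟨ x₀≈ ⟩
          u₀ + ξ * tr u₀       ≈⟨ +-cong u₀≈0 (≈-trans (*-congˡ τ₀≈0) (zeroʳ ξ)) ⟩
          0# + 0#              ≈⟨ +-identityʳ 0# ⟩
          0#                   ∎)
          where
          open ≈-Reasoning
          bu₀≈0 : b * u₀ ≈ 0#
          bu₀≈0 = ≈-trans bu₀≈ (≈-trans (+-cong s₀≈0 (≈-trans (*-congʳ τ₀≈0) (zeroˡ c₁))) (+-identityʳ 0#))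
          u₀≈0 : u₀ ≈ 0#
          u₀≈0 with x*y≈0⇒x≈0⊎y≈0 bu₀≈0
          ... | inj₁ b≈0  = ⊥-elim (b≉0 b≈0)
          ... | inj₂ u₀≈0 = u₀≈0

        multiple⇒quotient : ∀ {x u u₀ c} → Constrained u → x ≈ u + ξ * tr u → Constrained u₀ → x₀ ≈ u₀ + ξ * tr u₀ →
                            tr (a * u) ≈ c * tr (a * u₀) → tr u ≈ c * tr u₀ → x * x₀ ⁻¹ ≈ c
        multiple⇒quotient {x} {u} {u₀} {c} (_ , bu≈) x≈ (_ , bu₀≈) x₀≈ s≈ τ≈ = begin
          x * x₀ ⁻¹
            ≈⟨ *-congʳ (≈-trans x≈ (+-cong u≈cu₀ (*-congˡ τ≈))) ⟩
          (c * u₀ + ξ * (c * tr u₀)) * x₀ ⁻¹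
            ≈⟨ *-congʳ (solve 4 (λ c u ξ τ → c :* u :+ ξ :* (c :* τ) := c :* (u :+ ξ :* τ)) ≈-refl c u₀ ξ (tr u₀)) ⟩
          (c * (u₀ + ξ * tr u₀)) * x₀ ⁻¹
            ≈⟨ *-congʳ (*-congˡ x₀≈) ⟨
          (c * x₀) * x₀ ⁻¹
            ≈⟨ *-assoc _ _ _ ⟩
          c * (x₀ * x₀ ⁻¹)
            ≈⟨ *-congˡ (x*x⁻¹≈1 x₀≉0) ⟩
          c * 1#
            ≈⟨ *-identityʳ c ⟩
          c ∎
          where
          open ≈-Reasoning
          u≈cu₀ : u ≈ c * u₀
          u≈cu₀ = *-cancelʳ b≉0 (begin
            u * b                                   ≈⟨ *-comm u b ⟩
            b * u                                   ≈⟨ bu≈ ⟩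
            tr (a * u) + tr u * c₁                  ≈⟨ +-cong s≈ (*-congʳ τ≈) ⟩
            c * tr (a * u₀) + (c * tr u₀) * c₁      ≈⟨ solve 4 (λ c s τ k → c :* s :+ (c :* τ) :* k := c :* (s :+ τ :* k)) ≈-refl c _ _ c₁ ⟩
            c * (tr (a * u₀) + tr u₀ * c₁)          ≈⟨ *-congˡ bu₀≈ ⟨
            c * (b * u₀)                            ≈⟨ solve 3 (λ c b u → c :* (b :* u) := (c :* u) :* b) ≈-refl c b u₀ ⟩
            (c * u₀) * b                            ∎)

        W-multiple : ∀ {x} → T (W? α x) → InFq (x * x₀ ⁻¹)
        W-multiple x∈W =
          let (u , u-con , x≈)             = W-coordinates x∈W
              (u₀ , u₀-con , x₀≈)          = W-coordinates x₀∈W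
              (_ , _ , ρ≉0 , annihilates) = annihilator
              (c , c∈Fq , s≈ , τ≈)         = Fq.proportional
                (tr-Fq (Fqᵗ.fixed-* a∈ (proj₁ u-con))) (tr-Fq (proj₁ u-con))
                (tr-Fq (Fqᵗ.fixed-* a∈ (proj₁ u₀-con))) (tr-Fq (proj₁ u₀-con))
                (coordinates≉0 u₀-con x₀≈)
                (solutions-parallel ρ≉0 (annihilates u-con) (annihilates u₀-con))
          in Fq.fixed-resp (≈-sym (multiple⇒quotient u-con x≈ u₀-con x₀≈ s≈ τ≈)) c∈Fq

        count-W≡q : count (W? α) ≡ q
        count-W≡q = ≡.trans (count-bijection divide-by-x₀) count-Fq
          where
          divide-by-x₀ : IsBijection (W? α) Fq.fixed? (_* x₀ ⁻¹)
          divide-by-x₀ = record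
            { D-resp = W-resp α
            ; E-resp = Fq.fixed?-resp
            ; f-cong = *-congʳ
            ; f-inj  = λ _ _ → *-cancelʳ (x≉0⇒x⁻¹≉0 x₀≉0)
            ; f-into = ≈⇒≈ᵇ ∘ W-multiple
            ; f-onto = λ {y} y∈Fq → let y∈′ = ≈ᵇ⇒≈ y∈Fq ; (x₀∈S , αx₀∈S) = to T-∧ x₀∈W in
                y * x₀ ,
                from T-∧ (S-scale y∈′ x₀∈S ,
                          S-resp (solve 3 (λ y a x → y :* (a :* x) := a :* (y :* x)) ≈-refl y α x₀) (S-scale y∈′ αx₀∈S)) ,
                ≈-trans (*-assoc _ _ _) (≈-trans (*-congˡ (x*x⁻¹≈1 x₀≉0)) (*-identityʳ y))
            }

open import Data.Nat using (_^_; _≥_; _∸_)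

-- Neither p ≢ 2 nor, in the last case, α ≉ 0 is needed by this argument.
proposition4p3 : (p e q t : ℕ) → Prime p → ¬ (p ≡ 2) → e ≥ 1 → q ≡ p ^ e → t ≥ 1 →
    (K : FiniteField) → FiniteField.size K ≡ q ^ (2 ℕ.* t) →
    let open FiniteField K in
    (ξ A B : Carrier) →
    ¬ InSubfield K q t ξ →
    InSubfield K q t A → InSubfield K q t B →
    ξ * ξ ≈ A * ξ + B →
    ¬ (Tr K q t A ≈ - (1# + 1#)) →
    (α : Carrier) → InL K q t ξ α →
    (¬ InSubfield K q t α → WeightIs K q t ξ α 1)
    × (InSubfield K q t α → ¬ InSubfield K q 1 α → WeightIs K q t ξ α (t ∸ 2))
    × (InSubfield K q 1 α → ¬ (α ≈ 0#) → WeightIs K q t ξ α t)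
proposition4p3 p e q t p-prime _ 1≤e q≡pᵉ 1≤t K size≡q^[2t] ξ A B ξ∉Fqᵗ A∈Fqᵗ B∈Fqᵗ ξ²≈Aξ+B trA≉-2 α α∈L =
  outside-Fqᵗ , inside-Fqᵗ , inside-Fq
  where
  open FiniteField K using (_≈_; 0#)
  open QuadraticExtension K p-prime 1≤e q≡pᵉ 1≤t size≡q^[2t]
    using (InFqᵗ; InSubfield-1⇒InFq; InFq⇒InSubfield-1; module Basis)
  open Basis ξ ξ∉Fqᵗ
    using (InL⇒W; pointCount≡count-W; count-W≡q^t; module InsideFqᵗ; module OutsideFqᵗ)

  outside-Fqᵗ : ¬ InFqᵗ α → WeightIs K q t ξ α 1
  outside-Fqᵗ α∉Fqᵗ = let (_ , x₀∈W , x₀≉0) = InL⇒W α∈L in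
    ≡.trans (pointCount≡count-W α)
      (≡.trans (OutsideFqᵗ.count-W≡q A∈Fqᵗ B∈Fqᵗ ξ²≈Aξ+B trA≉-2 α∉Fqᵗ x₀∈W x₀≉0) (≡.sym (ℕP.*-identityʳ q)))

  inside-Fqᵗ : InFqᵗ α → ¬ InSubfield K q 1 α → WeightIs K q t ξ α (t ∸ 2)
  inside-Fqᵗ α∈Fqᵗ α∉Fq =
    ≡.trans (pointCount≡count-W α) (InsideFqᵗ.count-W≡q^[t∸2] α∈Fqᵗ (α∉Fq ∘ InFq⇒InSubfield-1))

  inside-Fq : InSubfield K q 1 α → ¬ α ≈ 0# → WeightIs K q t ξ α t
  inside-Fq α∈Fq _ = ≡.trans (pointCount≡count-W α) (count-W≡q^t (InSubfield-1⇒InFq α∈Fq))
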